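{- Let $n\ge1$, $m=\binom{2n}{2}$, and let $\mathbb{F}$ be a finite field of constant characteristic $q>2$. Let $f(\bar w)=\prod_{i<j\in[2n]}(1-w_{i,j})-2\in\mathbb{F}[\bar w]$ with $\bar w=\{w_{i,j}\}_{i<j\in[2n]}$, and let $f^\star(\bar z,\bar x)\in\mathbb{F}[\{z_{i,j}\}_{i<j\in[2n]},x_1,\dots,x_{2n}]$ be obtained from $f$ by substituting $w_{i,j}\mapsto z_{i,j}x_ix_j$. Then every roABP-$\mathrm{IPS}_{\mathrm{LIN}'}$ refutation of $f^\star(\bar z,\bar x)=0$, in any variable order, has size $2^{\Omega(n)}$.
   Context: A read-once oblivious algebraic branching program (roABP) in variable order $v_{\pi(1)}<\dots<v_{\pi(N)}$ is a layered directed acyclic graph with layers $V_0,\dots,V_N$, a unique source in $V_0$ and sink in $V_N$, edges only from $V_{\ell-1}$ to $V_\ell$, each labelled by a univariate polynomial in $v_{\pi(\ell)}$; it computes the sum over source–sink paths of the product of edge labels. Its width $r$ is $\max_\ell|V_\ell|$ and its size is $N\cdot r\cdot D\cdot N$ where $D$ is the maximal individual degree of labels. A roABP-$\mathrm{IPS}_{\mathrm{LIN}'}$ refutation of a system $\{g_1=0,\dots,g_k=0\}$ in variables $v_1,\dots,v_N$ is a polynomial $C(\bar v,t_1,\dots,t_k,s_1,\dots,s_N)$ computed by an roABP (in some order of all its variables) such that $C(\bar v,\bar0,\bar0)=0$, $C(\bar v,g_1,\dots,g_k,v_1^2-v_1,\dots,v_N^2-v_N)=1$, and $C$ has degree $\le1$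 in each $t_j$; its size is the size of the roABP. -}

module Defs where

open import Level using (Level; _⊔_) renaming (suc to lsuc)
open import Data.Nat as ℕ using (ℕ; zero; suc; _∸_; _≤_; _<_)
open import Data.Nat.Properties using (_<?_)
open import Data.Fin as Fin using (Fin; zero; suc; _↑ˡ_; _↑ʳ_; splitAt)
open import Data.Fin.Permutation using (Permutation′; _⟨$⟩ʳ_)
open import Data.Vec as Vec using (Vec; _∷_; []; tabulate; zipWith; replicate)
open import Data.Vec.Properties using (≡-dec)
open import Data.List as List using (List; _∷_; []; _++_; concatMap; filter; cartesianProduct; allFin; length)
open import Data.Product using (Σ; ∃; _×_; _,_; proj₁; proj₂)
open import Data.Sum using (inj₁; inj₂)
open import Relation.Nullary using (¬_; yes; no)
open import Relation.Binary.PropositionalEquality using (_≡_)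
open import Algebra.Bundles using (CommutativeRing)

record IsField {c ℓ} (F : CommutativeRing c ℓ) : Set (c ⊔ ℓ) where
  open CommutativeRing F using (Carrier; _≈_; _+_; _*_; -_; 0#; 1#)
  field
    1≉0    : ¬ (1# ≈ 0#)
    invert : ∀ x → ¬ (x ≈ 0#) → ∃ λ y → x * y ≈ 1#

IsFinite : ∀ {c ℓ} (F : CommutativeRing c ℓ) → Set (c ⊔ ℓ)
IsFinite F = Σ ℕ λ k → Σ (Fin k → Carrier) λ f → ∀ x → ∃ λ i → f i ≈ x
  where open CommutativeRing F

record IsFiniteField {c ℓ} (F : CommutativeRing c ℓ) : Set (c ⊔ ℓ) where
  field
    isField  : IsField F
    isFinite : IsFinite F

natElem : ∀ {c ℓ} (F : CommutativeRing c ℓ) → ℕ → CommutativeRing.Carrier F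
natElem F zero    = CommutativeRing.0# F
natElem F (suc n) = CommutativeRing._+_ F (CommutativeRing.1# F) (natElem F n)

-- For a prime q, "q · 1 = 0" says exactly that the characteristic is q
-- (in a field, where 1 ≠ 0).
HasCharacteristic : ∀ {c ℓ} (F : CommutativeRing c ℓ) → ℕ → Set ℓ
HasCharacteristic F q = CommutativeRing._≈_ F (natElem F q) (CommutativeRing.0# F)

maxFin : (n : ℕ) → (Fin n → ℕ) → ℕ
maxFin zero    f = 0
maxFin (suc n) f = f zero ℕ.⊔ maxFin n (λ i → f (suc i))

-- Equality is
-- equality of all coefficients (formal polynomial identity).

module Poly {c ℓ} (F : CommutativeRing c ℓ) where
  open CommutativeRing F using (Carrier; _≈_; _+_; _*_; -_; 0#; 1#)

  Mono : ℕ → Set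
  Mono M = Vec ℕ M

  Pol : ℕ → Set c
  Pol M = List (Carrier × Mono M)

  coeff : ∀ {M} → Pol M → Mono M → Carrier
  coeff []             e = 0#
  coeff ((a , e') ∷ p) e with ≡-dec ℕ._≟_ e' e
  ... | yes _ = a + coeff p e
  ... | no  _ = coeff p e

  infix 4 _≈P_
  _≈P_ : ∀ {M} → Pol M → Pol M → Set ℓ
  p ≈P q = ∀ e → coeff p e ≈ coeff q e

  const : ∀ {M} → Carrier → Pol M
  const a = (a , replicate _ 0) ∷ []

  zeroP oneP : ∀ {M} → Pol M
  zeroP = []
  oneP  = const 1#

  var : ∀ {M} → Fin M → Pol M
  var i = (1# , tabulate (λ j → unit j)) ∷ []
    where
      unit : Fin _ → ℕ
      unit j with i Fin.≟ j
      ... | yes _ = 1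
      ... | no  _ = 0

  _+P_ : ∀ {M} → Pol M → Pol M → Pol M
  p +P q = p ++ q

  -P_ : ∀ {M} → Pol M → Pol M
  -P p = List.map (λ t → (- proj₁ t , proj₂ t)) p

  _-P_ : ∀ {M} → Pol M → Pol M → Pol M
  p -P q = p +P (-P q)

  _*P_ : ∀ {M} → Pol M → Pol M → Pol M
  p *P q = concatMap (λ s → List.map (λ t → (proj₁ s * proj₁ t , zipWith ℕ._+_ (proj₂ s) (proj₂ t))) q) p

  _^P_ : ∀ {M} → Pol M → ℕ → Pol M
  p ^P zero  = oneP
  p ^P suc n = p *P (p ^P n)

  prodP : ∀ {M} → List (Pol M) → Pol M
  prodP = List.foldr _*P_ oneP

  prodPow : ∀ {M K} → Vec (Pol M) K → Vec ℕ K → Pol M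
  prodPow []       []       = oneP
  prodPow (p ∷ ps) (d ∷ ds) = (p ^P d) *P prodPow ps ds

  substP : ∀ {M N} → Pol M → (Fin M → Pol N) → Pol N
  substP []            σ = zeroP
  substP ((a , e) ∷ p) σ = (const a *P prodPow (tabulate σ) e) +P substP p σ

  uni : ∀ {M} → Fin M → List Carrier → Pol M
  uni i []       = zeroP
  uni i (a ∷ as) = const a +P (var i *P uni i as)

  sumFin : ∀ {M} (n : ℕ) → (Fin n → Pol M) → Pol M
  sumFin zero    f = zeroP
  sumFin (suc n) f = f zero +P sumFin n (λ j → f (suc j))

  -- Layered algebraic branching programs.
  -- 'ABP w k': a program whose current layer has w nodes and which has k
  -- more edge layers; the last layer has exactly one node (the sink).
  -- Edge labels are univariate polynomials (coefficient lists); the zero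
  -- polynomial [] means "no edge".
  data ABP : ℕ → ℕ → Set c where
    done  : ABP 1 0
    layer : ∀ {w₀ w₁ k} → (Fin w₀ → Fin w₁ → List Carrier) → ABP w₁ k → ABP w₀ (suc k)

  -- polynomial computed from each node of the current layer to the sink,
  -- where the layer-t edges are labelled by polynomials in variable x (t)
  evalABP : ∀ {M w k} → (Fin k → Fin M) → ABP w k → Fin w → Pol M
  evalABP x done          a = oneP
  evalABP x (layer L rest) a =
    sumFin _ (λ b → uni (x zero) (L a b) *P evalABP (λ t → x (suc t)) rest b)

  widthABP : ∀ {w k} → ABP w k → ℕ
  widthABP {w} done          = w
  widthABP {w} (layer L rest) = w ℕ.⊔ widthABP rest

  degABP : ∀ {w k} → ABP w k → ℕ
  degABP done = 0
  degABP {w₀} (layer {w₁ = w₁} L rest) =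
    maxFin w₀ (λ a → maxFin w₁ (λ b → length (L a b) ∸ 1)) ℕ.⊔ degABP rest

  -- read-once oblivious ABP in M variables: a variable order π (layer t
  -- reads variable π t) and a program with unique source and sink.
  record RoABP (M : ℕ) : Set c where
    field
      order   : Permutation′ M
      program : ABP 1 M

    computed : Pol M
    computed = evalABP (order ⟨$⟩ʳ_) program zero

    width : ℕ
    width = widthABP program

    degree : ℕ
    degree = degABP program

    size : ℕ
    size = M ℕ.* width ℕ.* degree ℕ.* M

  -- The refutation polynomial C has variables
  -- v (Fin N), t (Fin k), s (Fin N), laid out as Fin (N + (k + N)).
  module _ (N k : ℕ) where
    vVar : Fin N → Fin (N ℕ.+ (k ℕ.+ N))
    vVar i = i ↑ˡ (k ℕ.+ N)

    tVar : Fin k → Fin (N ℕ.+ (k ℕ.+ N))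
    tVar j = N ↑ʳ (j ↑ˡ N)

    sVar : Fin N → Fin (N ℕ.+ (k ℕ.+ N))
    sVar i = N ↑ʳ (k ↑ʳ i)

    σ₀ : Fin (N ℕ.+ (k ℕ.+ N)) → Pol N
    σ₀ y with splitAt N y
    ... | inj₁ i = var i
    ... | inj₂ _ = zeroP

    σ₁ : (Fin k → Pol N) → Fin (N ℕ.+ (k ℕ.+ N)) → Pol N
    σ₁ g y with splitAt N y
    ... | inj₁ i = var i
    ... | inj₂ z with splitAt k z
    ...   | inj₁ j = g j
    ...   | inj₂ i = (var i *P var i) -P var i

  record Refutation {N k : ℕ} (g : Fin k → Pol N) : Set (c ⊔ ℓ) where
    field
      roABP : RoABP (N ℕ.+ (k ℕ.+ N))
    open RoABP roABP public
    field
      atZero   : substP computed (σ₀ N k) ≈P zeroP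
      atSystem : substP computed (σ₁ N k g) ≈P oneP
      linearT  : ∀ j (e : Mono (N ℕ.+ (k ℕ.+ N))) → 2 ≤ Vec.lookup e (tVar N k j) →
                 coeff computed e ≈ 0#

  pairs : (k : ℕ) → List (Fin k × Fin k)
  pairs k = filter (λ p → Fin.toℕ (proj₁ p) <? Fin.toℕ (proj₂ p))
                   (cartesianProduct (allFin k) (allFin k))

  mPairs : ℕ → ℕ
  mPairs n = length (pairs (2 ℕ.* n))

  two : ∀ {M} → Pol M
  two = const (1# + 1#)

  -- f(w) = ∏_{i<j} (1 − w_{i,j}) − 2, with w_{i,j} the variable indexed by
  -- the position of (i , j) in 'pairs (2n)'
  fPoly : (n : ℕ) → Pol (mPairs n)
  fPoly n = prodP (List.map (λ p → oneP -P var p) (allFin (mPairs n))) -P two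

  NStar : ℕ → ℕ
  NStar n = mPairs n ℕ.+ 2 ℕ.* n

  zVar : ∀ n → Fin (mPairs n) → Fin (NStar n)
  zVar n p = p ↑ˡ (2 ℕ.* n)

  xVar : ∀ n → Fin (2 ℕ.* n) → Fin (NStar n)
  xVar n i = mPairs n ↑ʳ i

  fStar : (n : ℕ) → Pol (NStar n)
  fStar n = substP (fPoly n) sub
    where
      sub : Fin (mPairs n) → Pol (NStar n)
      sub p = var (zVar n p) *P (var (xVar n (proj₁ ij)) *P var (xVar n (proj₂ ij)))
        where ij = List.lookup (pairs (2 ℕ.* n)) p

  fStarSystem : (n : ℕ) → Fin 1 → Pol (NStar n)
  fStarSystem n _ = fStar n

-- A refutation C(v, t, s) vanishes at t = 0 and is affine in t, so at a Boolean point v (where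
-- s = v² - v = 0) it equals t · G(v) with G(v) = C(v, 1, 0); at t = f*(v) it equals 1, hence
-- G(v) = 1 / f*(v), while f*(v) is 𝟙[no z_{i,j} x_i x_j is 1] - 2 there.  Pick a layer of the roABP
-- with n of the 2n variables x_i read before it and n after, pair them up, put α ∈ {0,1}ⁿ on the
-- first half, β on the second and set z_{i,j} = 1 exactly on the n pairs: then -1 - 2 G is the
-- disjointness matrix of α and β, which is invertible of size 2ⁿ.  Cutting the program at that layer
-- writes G(α, β) as a sum of at most width products prefix(α) · suffix(β), so 2ⁿ ≤ width + 1.

module Submission where

open import Defs
open import Algebra.Bundles using (CommutativeRing)
import Data.Nat as ℕ
open ℕ using (ℕ)
open import Data.Fin using (Fin)

-- ℤ maps homomorphically into every commutative ring, which instantiates the library's ring solver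
-- with integer coefficients.
module IntegerSolver {c ℓ} (F : CommutativeRing c ℓ) where

  open import Data.Nat as ℕ using (ℕ; zero; suc)
  import Data.Nat.Properties as ℕ
  open import Data.Integer as ℤ using (ℤ; +_; -[1+_]; _⊖_)
  import Data.Integer.Properties as ℤ
  open import Data.Maybe using (Maybe; just; nothing)
  open import Data.Sum using (inj₁; inj₂)
  open import Relation.Nullary using (yes; no)
  open import Relation.Binary.PropositionalEquality as ≡ using (_≡_)
  open import Algebra.Solver.Ring.AlmostCommutativeRing
    using (fromCommutativeRing; _-Raw-AlmostCommutative⟶_)
  import Algebra.Solver.Ring
  import Algebra.Properties.Ring
  import Algebra.Properties.AbelianGroup
  import Algebra.Properties.Semiring.Mult.TCOptimised
  import Relation.Binary.Reasoning.Setoid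

  open CommutativeRing F
  open Algebra.Properties.Ring ring using (-‿distribˡ-*; -‿distribʳ-*; -‿involutive; -0#≈0#)
  open Algebra.Properties.AbelianGroup +-abelianGroup using (⁻¹-∙-comm)
  open Algebra.Properties.Semiring.Mult.TCOptimised semiring using (_×_; ×-homo-+; ×1-homo-*)
  open Relation.Binary.Reasoning.Setoid setoid

  ℤ→F : ℤ → Carrier
  ℤ→F (+ n)    = n × 1#
  ℤ→F -[1+ n ] = - (suc n × 1#)

  ℤ→F-neg : ∀ i → ℤ→F (ℤ.- i) ≈ - ℤ→F i
  ℤ→F-neg (+ zero)  = sym -0#≈0#
  ℤ→F-neg (+ suc n) = refl
  ℤ→F-neg -[1+ n ]  = sym (-‿involutive _)

  ℤ→F-⊖ : ∀ m n → ℤ→F (m ⊖ n) ≈ m × 1# - n × 1#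
  ℤ→F-⊖ m n with ℕ.≤-<-connex n m
  ... | inj₁ n≤m = begin
    ℤ→F (m ⊖ n)                         ≡⟨ ≡.cong ℤ→F (ℤ.⊖-≥ n≤m) ⟩
    (m ℕ.∸ n) × 1#                       ≈⟨ x≈[x+y]-y _ _ ⟩
    ((m ℕ.∸ n) × 1# + n × 1#) - n × 1#   ≈⟨ +-congʳ (sym (×-homo-+ 1# (m ℕ.∸ n) n)) ⟩
    (m ℕ.∸ n ℕ.+ n) × 1# - n × 1#        ≡⟨ ≡.cong (λ k → k × 1# - n × 1#) (ℕ.m∸n+n≡m n≤m) ⟩
    m × 1# - n × 1#                      ∎
    where
    x≈[x+y]-y : ∀ x y → x ≈ (x + y) - y
    x≈[x+y]-y x y = sym (trans (+-assoc x y (- y)) (trans (+-congˡ (-‿inverseʳ y)) (+-identityʳ x)))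
  ... | inj₂ m<n = begin
    ℤ→F (m ⊖ n)                           ≡⟨ ≡.cong ℤ→F (ℤ.⊖-< m<n) ⟩
    ℤ→F (ℤ.- + (n ℕ.∸ m))                  ≈⟨ ℤ→F-neg (+ (n ℕ.∸ m)) ⟩
    - ((n ℕ.∸ m) × 1#)                     ≈⟨ -x≈y-[x+y] _ _ ⟩
    m × 1# - ((n ℕ.∸ m) × 1# + m × 1#)     ≈⟨ +-congˡ (-‿cong (sym (×-homo-+ 1# (n ℕ.∸ m) m))) ⟩
    m × 1# - (n ℕ.∸ m ℕ.+ m) × 1#          ≡⟨ ≡.cong (λ k → m × 1# - k × 1#) (ℕ.m∸n+n≡m (ℕ.<⇒≤ m<n)) ⟩
    m × 1# - n × 1#                        ∎
    where
    -x≈y-[x+y] : ∀ x y → - x ≈ y - (x + y)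
    -x≈y-[x+y] x y = begin
      - x                ≈⟨ sym (+-identityˡ _) ⟩
      0# + - x           ≈⟨ +-congʳ (sym (-‿inverseʳ y)) ⟩
      (y - y) + - x      ≈⟨ +-assoc _ _ _ ⟩
      y + (- y + - x)    ≈⟨ +-congˡ (trans (+-comm _ _) (⁻¹-∙-comm x y)) ⟩
      y - (x + y)        ∎

  ℤ→F-+ : ∀ i j → ℤ→F (i ℤ.+ j) ≈ ℤ→F i + ℤ→F j
  ℤ→F-+ (+ m)    (+ n)    = ×-homo-+ 1# m n
  ℤ→F-+ (+ m)    -[1+ n ] = ℤ→F-⊖ m (suc n)
  ℤ→F-+ -[1+ m ] (+ n)    = trans (ℤ→F-⊖ n (suc m)) (+-comm _ _)
  ℤ→F-+ -[1+ m ] -[1+ n ] = begin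
    - (suc (suc (m ℕ.+ n)) × 1#)        ≡⟨ ≡.cong (λ k → - (suc k × 1#)) (≡.sym (ℕ.+-suc m n)) ⟩
    - ((suc m ℕ.+ suc n) × 1#)          ≈⟨ -‿cong (×-homo-+ 1# (suc m) (suc n)) ⟩
    - (suc m × 1# + suc n × 1#)         ≈⟨ ⁻¹-∙-comm _ _ ⟨
    - (suc m × 1#) + - (suc n × 1#)     ∎

  ℤ→F-+* : ∀ m j → ℤ→F (+ m ℤ.* j) ≈ ℤ→F (+ m) * ℤ→F j
  ℤ→F-+* m (+ n) = trans (reflexive (≡.cong ℤ→F (≡.sym (ℤ.pos-* m n)))) (×1-homo-* m n)
  ℤ→F-+* m -[1+ n ] = begin
    ℤ→F (+ m ℤ.* ℤ.- + suc n)    ≡⟨ ≡.cong ℤ→F (ℤ.neg-distribʳ-* (+ m) (+ suc n)) ⟨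
    ℤ→F (ℤ.- (+ m ℤ.* + suc n))  ≈⟨ ℤ→F-neg (+ m ℤ.* + suc n) ⟩
    - ℤ→F (+ m ℤ.* + suc n)      ≈⟨ -‿cong (ℤ→F-+* m (+ suc n)) ⟩
    - (m × 1# * suc n × 1#)      ≈⟨ -‿distribʳ-* _ _ ⟩
    m × 1# * - (suc n × 1#)      ∎

  ℤ→F-* : ∀ i j → ℤ→F (i ℤ.* j) ≈ ℤ→F i * ℤ→F j
  ℤ→F-* (+ m)    j = ℤ→F-+* m j
  ℤ→F-* -[1+ m ] j = begin
    ℤ→F (ℤ.- + suc m ℤ.* j)      ≡⟨ ≡.cong ℤ→F (ℤ.neg-distribˡ-* (+ suc m) j) ⟨
    ℤ→F (ℤ.- (+ suc m ℤ.* j))    ≈⟨ ℤ→F-neg (+ suc m ℤ.* j) ⟩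
    - ℤ→F (+ suc m ℤ.* j)        ≈⟨ -‿cong (ℤ→F-+* (suc m) j) ⟩
    - (suc m × 1# * ℤ→F j)       ≈⟨ -‿distribˡ-* _ _ ⟩
    - (suc m × 1#) * ℤ→F j       ∎

  ℤ→F-homomorphism : ℤ.+-*-rawRing -Raw-AlmostCommutative⟶ fromCommutativeRing F
  ℤ→F-homomorphism = record
    { ⟦_⟧ = ℤ→F ; +-homo = ℤ→F-+ ; *-homo = ℤ→F-* ; -‿homo = ℤ→F-neg
    ; 0-homo = refl ; 1-homo = refl }

  ℤ→F-weaklyDecidable : ∀ i j → Maybe (ℤ→F i ≈ ℤ→F j)
  ℤ→F-weaklyDecidable i j with i ℤ.≟ j
  ... | yes ≡.refl = just refl
  ... | no _       = nothing

  open Algebra.Solver.Ring ℤ.+-*-rawRing (fromCommutativeRing F)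
    ℤ→F-homomorphism ℤ→F-weaklyDecidable public

  :0 :1 :2 : ∀ {n} → Polynomial n
  :0 = con (+ 0)
  :1 = con (+ 1)
  :2 = con (+ 2)

module Evaluation {c ℓ} (F : CommutativeRing c ℓ) where

  open import Algebra.Bundles using (CommutativeRing; Semiring)
  open import Level using (_⊔_)
  open import Data.Nat as ℕ using (ℕ; zero; suc; _≤_; z≤n; s≤s)
  import Data.Nat.Properties as ℕ
  open import Data.Fin as Fin using (Fin; zero; suc)
  import Data.Fin.Properties as FinP
  open import Data.Vec as Vec using (Vec; []; _∷_)
  open import Data.Vec.Properties using (≡-dec; lookup∘tabulate; lookup-replicate)
  open import Data.List as List using (List; []; _∷_; _++_; length; filter)
  open import Data.List.Properties using (length-filter)
  open import Data.Product using (_,_; proj₁; proj₂)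
  open import Data.Bool using (if_then_else_)
  open import Relation.Nullary using (¬_; yes; no; does; contradiction)
  open import Relation.Nullary.Decidable using (¬?)
  open import Relation.Unary using (Decidable)
  open import Relation.Binary.PropositionalEquality as ≡ using (_≡_; _≢_)
  open import Function using (_∘_)
  import Algebra.Definitions.RawSemiring
  import Algebra.Properties.Semiring.Exp
  import Algebra.Properties.Semiring.Sum
  import Algebra.Properties.Ring
  import Relation.Binary.Reasoning.Setoid

  open CommutativeRing F hiding (zero)
  open Poly F
  open Algebra.Definitions.RawSemiring (Semiring.rawSemiring semiring) using (_^_)
  open Algebra.Properties.Semiring.Exp semiring using (^-congˡ; ^-homo-*)
  open Algebra.Properties.Ring ring using (-0#≈0#)
  open Algebra.Properties.Semiring.Sum semiring using (sum; sum-syntax)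
  open IntegerSolver F using (solve; _:=_; _:+_; _:*_; :-_; _:-_; :0; :1)
  open Relation.Binary.Reasoning.Setoid setoid

  Assignment : ℕ → Set c
  Assignment M = Fin M → Carrier

  infix 4 _≋_
  _≋_ : ∀ {M} → Assignment M → Assignment M → Set ℓ
  ρ ≋ ρ′ = ∀ i → ρ i ≈ ρ′ i

  ⟦_⟧ₘ : ∀ {M} → Mono M → Assignment M → Carrier
  ⟦ []    ⟧ₘ ρ = 1#
  ⟦ d ∷ e ⟧ₘ ρ = ρ zero ^ d * ⟦ e ⟧ₘ (ρ ∘ suc)

  ⟦_⟧ : ∀ {M} → Pol M → Assignment M → Carrier
  ⟦ []          ⟧ ρ = 0#
  ⟦ (a , e) ∷ p ⟧ ρ = a * ⟦ e ⟧ₘ ρ + ⟦ p ⟧ ρ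

  ⟦⟧ₘ-cong : ∀ {M} (e : Mono M) {ρ ρ′} → ρ ≋ ρ′ → ⟦ e ⟧ₘ ρ ≈ ⟦ e ⟧ₘ ρ′
  ⟦⟧ₘ-cong []      ρ≋ρ′ = refl
  ⟦⟧ₘ-cong (d ∷ e) ρ≋ρ′ = *-cong (^-congˡ d (ρ≋ρ′ zero)) (⟦⟧ₘ-cong e (ρ≋ρ′ ∘ suc))

  ⟦⟧-cong : ∀ {M} (p : Pol M) {ρ ρ′} → ρ ≋ ρ′ → ⟦ p ⟧ ρ ≈ ⟦ p ⟧ ρ′
  ⟦⟧-cong []            ρ≋ρ′ = refl
  ⟦⟧-cong ((a , e) ∷ p) ρ≋ρ′ = +-cong (*-congˡ (⟦⟧ₘ-cong e ρ≋ρ′)) (⟦⟧-cong p ρ≋ρ′)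

  ⟦⟧ₘ-zipWith-+ : ∀ {M} (e e′ : Mono M) ρ → ⟦ Vec.zipWith ℕ._+_ e e′ ⟧ₘ ρ ≈ ⟦ e ⟧ₘ ρ * ⟦ e′ ⟧ₘ ρ
  ⟦⟧ₘ-zipWith-+ []      []        ρ = sym (*-identityˡ 1#)
  ⟦⟧ₘ-zipWith-+ (d ∷ e) (d′ ∷ e′) ρ = begin
    ρ zero ^ (d ℕ.+ d′) * ⟦ Vec.zipWith ℕ._+_ e e′ ⟧ₘ (ρ ∘ suc)
      ≈⟨ *-cong (^-homo-* (ρ zero) d d′) (⟦⟧ₘ-zipWith-+ e e′ (ρ ∘ suc)) ⟩
    (ρ zero ^ d * ρ zero ^ d′) * (⟦ e ⟧ₘ (ρ ∘ suc) * ⟦ e′ ⟧ₘ (ρ ∘ suc))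
      ≈⟨ solve 4 (λ a b c d → (a :* b) :* (c :* d) := (a :* c) :* (b :* d)) refl _ _ _ _ ⟩
    (ρ zero ^ d * ⟦ e ⟧ₘ (ρ ∘ suc)) * (ρ zero ^ d′ * ⟦ e′ ⟧ₘ (ρ ∘ suc)) ∎

  ⟦⟧-+P : ∀ {M} (p q : Pol M) ρ → ⟦ p +P q ⟧ ρ ≈ ⟦ p ⟧ ρ + ⟦ q ⟧ ρ
  ⟦⟧-+P []            q ρ = sym (+-identityˡ _)
  ⟦⟧-+P ((a , e) ∷ p) q ρ = trans (+-congˡ (⟦⟧-+P p q ρ)) (sym (+-assoc _ _ _))

  ⟦⟧-negP : ∀ {M} (p : Pol M) ρ → ⟦ -P p ⟧ ρ ≈ - ⟦ p ⟧ ρ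
  ⟦⟧-negP []            ρ = sym -0#≈0#
  ⟦⟧-negP ((a , e) ∷ p) ρ = trans (+-congˡ (⟦⟧-negP p ρ))
    (solve 3 (λ a m r → (:- a) :* m :+ (:- r) := :- (a :* m :+ r)) refl a (⟦ e ⟧ₘ ρ) (⟦ p ⟧ ρ))

  ⟦⟧-subP : ∀ {M} (p q : Pol M) ρ → ⟦ p -P q ⟧ ρ ≈ ⟦ p ⟧ ρ - ⟦ q ⟧ ρ
  ⟦⟧-subP p q ρ = trans (⟦⟧-+P p (-P q) ρ) (+-congˡ (⟦⟧-negP q ρ))

  ⟦⟧-*P : ∀ {M} (p q : Pol M) ρ → ⟦ p *P q ⟧ ρ ≈ ⟦ p ⟧ ρ * ⟦ q ⟧ ρ
  ⟦⟧-*P []            q ρ = sym (zeroˡ _)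
  ⟦⟧-*P ((a , e) ∷ p) q ρ = begin
    ⟦ termTimes q ++ (p *P q) ⟧ ρ            ≈⟨ ⟦⟧-+P (termTimes q) (p *P q) ρ ⟩
    ⟦ termTimes q ⟧ ρ + ⟦ p *P q ⟧ ρ         ≈⟨ +-cong (⟦termTimes⟧ q) (⟦⟧-*P p q ρ) ⟩
    (a * ⟦ e ⟧ₘ ρ) * ⟦ q ⟧ ρ + ⟦ p ⟧ ρ * ⟦ q ⟧ ρ ≈⟨ distribʳ _ _ _ ⟨
    (a * ⟦ e ⟧ₘ ρ + ⟦ p ⟧ ρ) * ⟦ q ⟧ ρ        ∎
    where
    termTimes : Pol _ → Pol _
    termTimes = List.map (λ t → (a * proj₁ t , Vec.zipWith ℕ._+_ e (proj₂ t)))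

    ⟦termTimes⟧ : ∀ q → ⟦ termTimes q ⟧ ρ ≈ (a * ⟦ e ⟧ₘ ρ) * ⟦ q ⟧ ρ
    ⟦termTimes⟧ []             = sym (zeroʳ _)
    ⟦termTimes⟧ ((b , e′) ∷ q) = begin
      (a * b) * ⟦ Vec.zipWith ℕ._+_ e e′ ⟧ₘ ρ + ⟦ termTimes q ⟧ ρ
        ≈⟨ +-cong (*-congˡ (⟦⟧ₘ-zipWith-+ e e′ ρ)) (⟦termTimes⟧ q) ⟩
      (a * b) * (⟦ e ⟧ₘ ρ * ⟦ e′ ⟧ₘ ρ) + (a * ⟦ e ⟧ₘ ρ) * ⟦ q ⟧ ρ
        ≈⟨ solve 5 (λ a b m m′ r → (a :* b) :* (m :* m′) :+ (a :* m) :* r := (a :* m) :* (b :* m′ :+ r))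
             refl a b (⟦ e ⟧ₘ ρ) (⟦ e′ ⟧ₘ ρ) (⟦ q ⟧ ρ) ⟩
      (a * ⟦ e ⟧ₘ ρ) * (b * ⟦ e′ ⟧ₘ ρ + ⟦ q ⟧ ρ) ∎

  ⟦⟧ₘ-zeros : ∀ {M} (e : Mono M) ρ → (∀ j → Vec.lookup e j ≡ 0) → ⟦ e ⟧ₘ ρ ≈ 1#
  ⟦⟧ₘ-zeros []      ρ e≡0 = refl
  ⟦⟧ₘ-zeros (d ∷ e) ρ e≡0 rewrite e≡0 zero = trans (*-identityˡ _) (⟦⟧ₘ-zeros e (ρ ∘ suc) (e≡0 ∘ suc))

  ⟦⟧-const : ∀ {M} a (ρ : Assignment M) → ⟦ const a ⟧ ρ ≈ a
  ⟦⟧-const a ρ = trans (+-identityʳ _) (trans (*-congˡ (⟦⟧ₘ-zeros (Vec.replicate _ 0) ρ λ j → lookup-replicate j 0)) (*-identityʳ a))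

  private
    δ : ∀ {M} → Fin M → Fin M → ℕ
    δ i j = if does (i Fin.≟ j) then 1 else 0

  ⟦⟧ₘ-δ : ∀ {M} (i : Fin M) (e : Mono M) ρ → (∀ j → Vec.lookup e j ≡ δ i j) → ⟦ e ⟧ₘ ρ ≈ ρ i
  ⟦⟧ₘ-δ zero (d ∷ e) ρ e≡δ rewrite e≡δ zero = begin
    ρ zero * 1# * ⟦ e ⟧ₘ (ρ ∘ suc) ≈⟨ *-cong (*-identityʳ _) (⟦⟧ₘ-zeros e (ρ ∘ suc) (e≡δ ∘ suc)) ⟩
    ρ zero * 1#                    ≈⟨ *-identityʳ _ ⟩
    ρ zero                         ∎
  ⟦⟧ₘ-δ (suc i) (d ∷ e) ρ e≡δ rewrite e≡δ zero =
    trans (*-identityˡ _) (⟦⟧ₘ-δ i e (ρ ∘ suc) λ j → e≡δ (suc j))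

  -- The exponent vector of `var i` tabulates a local function of `Defs` that cannot be named here;
  -- `exponent-lookup` brings its application `unit j` into scope, where `with i Fin.≟ j` evaluates it.
  ⟦⟧-var : ∀ {M} (i : Fin M) ρ → ⟦ var i ⟧ ρ ≈ ρ i
  ⟦⟧-var i ρ = trans (+-identityʳ _) (trans (*-identityˡ _) (⟦⟧ₘ-δ i (exponent (var i)) ρ exponent≡δ))
    where
    exponent : Pol _ → Mono _
    exponent []            = Vec.replicate _ 0
    exponent ((_ , e) ∷ _) = e

    exponent-lookup : ∀ {M} {f : Fin M → ℕ} (e : Mono M) → e ≡ Vec.tabulate f → ∀ j → Vec.lookup e j ≡ f j
    exponent-lookup _ ≡.refl j = lookup∘tabulate _ j

    exponent≡δ : ∀ j → Vec.lookup (exponent (var i)) j ≡ δ i j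
    exponent≡δ j with exponent-lookup (exponent (var i)) ≡.refl j
    ... | eq with i Fin.≟ j
    ...   | yes _ = eq
    ...   | no  _ = eq

  ⟦⟧-^P : ∀ {M} (p : Pol M) n ρ → ⟦ p ^P n ⟧ ρ ≈ ⟦ p ⟧ ρ ^ n
  ⟦⟧-^P p zero    ρ = ⟦⟧-const 1# ρ
  ⟦⟧-^P p (suc n) ρ = trans (⟦⟧-*P p (p ^P n) ρ) (*-congˡ (⟦⟧-^P p n ρ))

  ⟦⟧-prodPow : ∀ {M K} (ps : Vec (Pol M) K) (e : Mono K) ρ →
               ⟦ prodPow ps e ⟧ ρ ≈ ⟦ e ⟧ₘ (λ k → ⟦ Vec.lookup ps k ⟧ ρ)
  ⟦⟧-prodPow []       []      ρ = ⟦⟧-const 1# ρ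
  ⟦⟧-prodPow (p ∷ ps) (d ∷ e) ρ =
    trans (⟦⟧-*P (p ^P d) (prodPow ps e) ρ) (*-cong (⟦⟧-^P p d ρ) (⟦⟧-prodPow ps e ρ))

  ⟦⟧-substP : ∀ {M N} (p : Pol M) (σ : Fin M → Pol N) ρ → ⟦ substP p σ ⟧ ρ ≈ ⟦ p ⟧ (λ i → ⟦ σ i ⟧ ρ)
  ⟦⟧-substP []            σ ρ = refl
  ⟦⟧-substP ((a , e) ∷ p) σ ρ = begin
    ⟦ (const a *P prodPow (Vec.tabulate σ) e) +P substP p σ ⟧ ρ
      ≈⟨ ⟦⟧-+P (const a *P prodPow (Vec.tabulate σ) e) (substP p σ) ρ ⟩
    ⟦ const a *P prodPow (Vec.tabulate σ) e ⟧ ρ + ⟦ substP p σ ⟧ ρ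
      ≈⟨ +-cong (⟦⟧-*P (const a) (prodPow (Vec.tabulate σ) e) ρ) (⟦⟧-substP p σ ρ) ⟩
    ⟦ const a ⟧ ρ * ⟦ prodPow (Vec.tabulate σ) e ⟧ ρ + ⟦ p ⟧ (λ i → ⟦ σ i ⟧ ρ)
      ≈⟨ +-congʳ (*-cong (⟦⟧-const a ρ) (trans (⟦⟧-prodPow (Vec.tabulate σ) e ρ)
           (⟦⟧ₘ-cong e λ k → reflexive (≡.cong (λ q → ⟦ q ⟧ ρ) (lookup∘tabulate σ k))))) ⟩
    a * ⟦ e ⟧ₘ (λ i → ⟦ σ i ⟧ ρ) + ⟦ p ⟧ (λ i → ⟦ σ i ⟧ ρ) ∎

  horner : List Carrier → Carrier → Carrier
  horner []       x = 0#
  horner (a ∷ as) x = a + x * horner as x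

  ⟦⟧-uni : ∀ {M} (i : Fin M) as ρ → ⟦ uni i as ⟧ ρ ≈ horner as (ρ i)
  ⟦⟧-uni i []       ρ = refl
  ⟦⟧-uni i (a ∷ as) ρ = trans (⟦⟧-+P (const a) (var i *P uni i as) ρ)
    (+-cong (⟦⟧-const a ρ) (trans (⟦⟧-*P (var i) (uni i as) ρ) (*-cong (⟦⟧-var i ρ) (⟦⟧-uni i as ρ))))

  ⟦⟧-sumFin : ∀ {M} n (f : Fin n → Pol M) ρ → ⟦ sumFin n f ⟧ ρ ≈ ∑[ j < n ] ⟦ f j ⟧ ρ
  ⟦⟧-sumFin zero    f ρ = refl
  ⟦⟧-sumFin (suc n) f ρ = trans (⟦⟧-+P (f zero) _ ρ) (+-congˡ (⟦⟧-sumFin n (f ∘ suc) ρ))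

  select : ∀ {M p} {P : Mono M → Set p} → Decidable P → Pol M → Pol M
  select P? = filter (P? ∘ proj₂)

  ⟦⟧-select-split : ∀ {M p} {P : Mono M → Set p} (P? : Decidable P) q ρ →
                    ⟦ q ⟧ ρ ≈ ⟦ select P? q ⟧ ρ + ⟦ select (¬? ∘ P?) q ⟧ ρ
  ⟦⟧-select-split P? []            ρ = sym (+-identityˡ 0#)
  ⟦⟧-select-split P? ((a , e) ∷ q) ρ with P? e
  ... | yes _ = trans (+-congˡ (⟦⟧-select-split P? q ρ)) (sym (+-assoc _ _ _))
  ... | no  _ = trans (+-congˡ (⟦⟧-select-split P? q ρ)) (solve 3 (λ x y z → x :+ (y :+ z) := y :+ (x :+ z)) refl _ _ _)

  coeff-select : ∀ {M p} {P : Mono M → Set p} (P? : Decidable P) q e → P e → coeff (select P? q) e ≈ coeff q e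
  coeff-select P? []             e Pe = refl
  coeff-select P? ((a , e′) ∷ q) e Pe with P? e′
  ... | yes _ with ≡-dec ℕ._≟_ e′ e
  ...   | yes _ = +-congˡ (coeff-select P? q e Pe)
  ...   | no  _ = coeff-select P? q e Pe
  coeff-select P? ((a , e′) ∷ q) e Pe | no ¬Pe′ with ≡-dec ℕ._≟_ e′ e
  ...   | yes ≡.refl = contradiction Pe ¬Pe′
  ...   | no  _      = coeff-select P? q e Pe

  coeff-select-¬ : ∀ {M p} {P : Mono M → Set p} (P? : Decidable P) q e → ¬ P e → coeff (select P? q) e ≈ 0#
  coeff-select-¬ P? []             e ¬Pe = refl
  coeff-select-¬ P? ((a , e′) ∷ q) e ¬Pe with P? e′
  ... | no _    = coeff-select-¬ P? q e ¬Pe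
  ... | yes Pe′ with ≡-dec ℕ._≟_ e′ e
  ...   | yes ≡.refl = contradiction Pe′ ¬Pe
  ...   | no  _      = coeff-select-¬ P? q e ¬Pe

  ⟦⟧-select-≡ : ∀ {M} (e₀ : Mono M) q ρ →
                ⟦ select (λ e → ≡-dec ℕ._≟_ e e₀) q ⟧ ρ ≈ coeff q e₀ * ⟦ e₀ ⟧ₘ ρ
  ⟦⟧-select-≡ e₀ []            ρ = sym (zeroˡ _)
  ⟦⟧-select-≡ e₀ ((a , e) ∷ q) ρ with ≡-dec ℕ._≟_ e e₀
  ... | yes ≡.refl = trans (+-congˡ (⟦⟧-select-≡ e₀ q ρ)) (sym (distribʳ _ _ _))
  ... | no  _      = ⟦⟧-select-≡ e₀ q ρ

  -- A formal sum with all coefficients zero may repeat exponents; grouping the terms with the exponent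
  -- of the first term removes them all at once, which makes the induction go through.
  vanishing⇒⟦⟧≈0 : ∀ {M} (q : Pol M) → (∀ e → coeff q e ≈ 0#) → ∀ ρ → ⟦ q ⟧ ρ ≈ 0#
  vanishing⇒⟦⟧≈0 q = go (length q) q ℕ.≤-refl
    where
    go : ∀ {M} n (q : Pol M) → length q ≤ n → (∀ e → coeff q e ≈ 0#) → ∀ ρ → ⟦ q ⟧ ρ ≈ 0#
    go n       []             _         _      ρ = refl
    go (suc n) ((a , e₀) ∷ q) (s≤s |q|≤n) q≈0 ρ = begin
      a * ⟦ e₀ ⟧ₘ ρ + ⟦ q ⟧ ρ
        ≈⟨ +-congˡ (⟦⟧-select-split same? q ρ) ⟩
      a * ⟦ e₀ ⟧ₘ ρ + (⟦ select same? q ⟧ ρ + ⟦ select (¬? ∘ same?) q ⟧ ρ)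
        ≈⟨ +-congˡ (+-cong (⟦⟧-select-≡ e₀ q ρ)
             (go n (select (¬? ∘ same?) q) (ℕ.≤-trans (length-filter _ q) |q|≤n) rest≈0 ρ)) ⟩
      a * ⟦ e₀ ⟧ₘ ρ + (coeff q e₀ * ⟦ e₀ ⟧ₘ ρ + 0#)
        ≈⟨ solve 3 (λ a c m → a :* m :+ (c :* m :+ :0) := (a :+ c) :* m) refl _ _ _ ⟩
      (a + coeff q e₀) * ⟦ e₀ ⟧ₘ ρ
        ≈⟨ *-congʳ head≈0 ⟩
      0# * ⟦ e₀ ⟧ₘ ρ
        ≈⟨ zeroˡ _ ⟩
      0# ∎
      where
      same? : Decidable (_≡ e₀)
      same? e = ≡-dec ℕ._≟_ e e₀

      head≈0 : a + coeff q e₀ ≈ 0#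
      head≈0 with q≈0 e₀
      ... | eq with ≡-dec ℕ._≟_ e₀ e₀
      ...   | yes _  = eq
      ...   | no e≢e = contradiction ≡.refl e≢e

      rest≈0 : ∀ e → coeff (select (¬? ∘ same?) q) e ≈ 0#
      rest≈0 e with same? e
      ... | yes e≡e₀ = coeff-select-¬ (¬? ∘ same?) q e (λ e≢e₀ → e≢e₀ e≡e₀)
      ... | no  e≢e₀ = trans (coeff-select (¬? ∘ same?) q e e≢e₀) (tail≈0 (q≈0 e))
        where
        tail≈0 : coeff ((a , e₀) ∷ q) e ≈ 0# → coeff q e ≈ 0#
        tail≈0 eq with ≡-dec ℕ._≟_ e₀ e
        ... | yes e₀≡e = contradiction (≡.sym e₀≡e) e≢e₀
        ... | no  _    = eq

  ≈P⇒⟦⟧≈ : ∀ {M} (p q : Pol M) → p ≈P q → ∀ ρ → ⟦ p ⟧ ρ ≈ ⟦ q ⟧ ρ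
  ≈P⇒⟦⟧≈ p q p≈q ρ = begin
    ⟦ p ⟧ ρ                       ≈⟨ solve 2 (λ x y → x := (x :- y) :+ y) refl _ _ ⟩
    (⟦ p ⟧ ρ - ⟦ q ⟧ ρ) + ⟦ q ⟧ ρ ≈⟨ +-congʳ (⟦⟧-subP p q ρ) ⟨
    ⟦ p -P q ⟧ ρ + ⟦ q ⟧ ρ        ≈⟨ +-congʳ (vanishing⇒⟦⟧≈0 (p -P q) p-q≈0 ρ) ⟩
    0# + ⟦ q ⟧ ρ                  ≈⟨ +-identityˡ _ ⟩
    ⟦ q ⟧ ρ                       ∎
    where
    coeff-negP : ∀ {M} (r : Pol M) e → coeff (-P r) e ≈ - coeff r e
    coeff-negP []             e = sym -0#≈0#
    coeff-negP ((a , e′) ∷ r) e with ≡-dec ℕ._≟_ e′ e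
    ... | yes _ = trans (+-congˡ (coeff-negP r e)) (solve 2 (λ x y → (:- x) :+ (:- y) := :- (x :+ y)) refl _ _)
    ... | no  _ = coeff-negP r e

    coeff-++ : ∀ {M} (r s : Pol M) e → coeff (r ++ s) e ≈ coeff r e + coeff s e
    coeff-++ []             s e = sym (+-identityˡ _)
    coeff-++ ((a , e′) ∷ r) s e with ≡-dec ℕ._≟_ e′ e
    ... | yes _ = trans (+-congˡ (coeff-++ r s e)) (sym (+-assoc _ _ _))
    ... | no  _ = coeff-++ r s e

    p-q≈0 : ∀ e → coeff (p -P q) e ≈ 0#
    p-q≈0 e = trans (coeff-++ p (-P q) e) (trans (+-cong (p≈q e) (coeff-negP q e)) (-‿inverseʳ _))

  Affine : (Carrier → Carrier) → Set (c ⊔ ℓ)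
  Affine g = ∀ x → g x ≈ g 0# + x * (g 1# - g 0#)

  Affine-resp : ∀ {g h} → (∀ x → g x ≈ h x) → Affine g → Affine h
  Affine-resp {g} {h} g≈h g-affine x = begin
    h x                          ≈⟨ g≈h x ⟨
    g x                          ≈⟨ g-affine x ⟩
    g 0# + x * (g 1# - g 0#)     ≈⟨ +-cong (g≈h 0#) (*-congˡ (+-cong (g≈h 1#) (-‿cong (g≈h 0#)))) ⟩
    h 0# + x * (h 1# - h 0#)     ∎

  Affine-+ : ∀ {g h} → Affine g → Affine h → Affine (λ x → g x + h x)
  Affine-+ {g} {h} g-affine h-affine x = trans (+-cong (g-affine x) (h-affine x))
    (solve 5 (λ x g₀ g₁ h₀ h₁ → (g₀ :+ x :* (g₁ :- g₀)) :+ (h₀ :+ x :* (h₁ :- h₀))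
                                := (g₀ :+ h₀) :+ x :* ((g₁ :+ h₁) :- (g₀ :+ h₀))) refl x _ _ _ _)

  Affine-scale : ∀ k c → k ℕ.< 2 → Affine (λ x → x ^ k * c)
  Affine-scale zero          c _ x = solve 2 (λ x u → u := u :+ x :* (u :- u)) refl x (1# * c)
  Affine-scale (suc zero)    c _ x =
    solve 2 (λ x c → x :* :1 :* c := :0 :* :1 :* c :+ x :* (:1 :* :1 :* c :- :0 :* :1 :* c)) refl x c
  Affine-scale (suc (suc k)) c (s≤s (s≤s ()))

  module _ {M} (j₀ : Fin M) (ρ : Carrier → Assignment M)
           (ρ-at : ∀ x → ρ x j₀ ≈ x) (ρ-off : ∀ x y j → j ≢ j₀ → ρ x j ≈ ρ y j) where

    ⟦⟧ₘ-factor : ∀ e x → ⟦ e ⟧ₘ (ρ x) ≈ x ^ Vec.lookup e j₀ * ⟦ e ⟧ₘ (ρ 1#)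
    ⟦⟧ₘ-factor e x = go j₀ (ρ x) (ρ 1#) (ρ-at x) (ρ-at 1#) (λ j → ρ-off x 1# j) e
      where
      1^n≈1 : ∀ n → 1# ^ n ≈ 1#
      1^n≈1 zero    = refl
      1^n≈1 (suc n) = trans (*-identityˡ _) (1^n≈1 n)

      go : ∀ {M} (j₀ : Fin M) (ρₓ ρ₁ : Assignment M) → ρₓ j₀ ≈ x → ρ₁ j₀ ≈ 1# →
           (∀ j → j ≢ j₀ → ρₓ j ≈ ρ₁ j) → ∀ e → ⟦ e ⟧ₘ ρₓ ≈ x ^ Vec.lookup e j₀ * ⟦ e ⟧ₘ ρ₁
      go zero ρₓ ρ₁ ρₓ-at ρ₁-at ρ-off (d ∷ e) = *-cong (^-congˡ d ρₓ-at) (begin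
        ⟦ e ⟧ₘ (ρₓ ∘ suc)              ≈⟨ ⟦⟧ₘ-cong e (λ j → ρ-off (suc j) λ ()) ⟩
        ⟦ e ⟧ₘ (ρ₁ ∘ suc)              ≈⟨ *-identityˡ _ ⟨
        1# * ⟦ e ⟧ₘ (ρ₁ ∘ suc)         ≈⟨ *-congʳ (trans (^-congˡ d ρ₁-at) (1^n≈1 d)) ⟨
        ρ₁ zero ^ d * ⟦ e ⟧ₘ (ρ₁ ∘ suc) ∎)
      go (suc j₀) ρₓ ρ₁ ρₓ-at ρ₁-at ρ-off (d ∷ e) = begin
        ρₓ zero ^ d * ⟦ e ⟧ₘ (ρₓ ∘ suc)
          ≈⟨ *-cong (^-congˡ d (ρ-off zero λ ()))
                    (go j₀ (ρₓ ∘ suc) (ρ₁ ∘ suc) ρₓ-at ρ₁-at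
                        (λ j j≢j₀ → ρ-off (suc j) (j≢j₀ ∘ FinP.suc-injective)) e) ⟩
        ρ₁ zero ^ d * (x ^ Vec.lookup e j₀ * ⟦ e ⟧ₘ (ρ₁ ∘ suc))
          ≈⟨ solve 3 (λ a b c → a :* (b :* c) := b :* (a :* c)) refl _ _ _ ⟩
        x ^ Vec.lookup e j₀ * (ρ₁ zero ^ d * ⟦ e ⟧ₘ (ρ₁ ∘ suc)) ∎

    private
      high? : Decidable (λ (e : Mono M) → 2 ≤ Vec.lookup e j₀)
      high? e = 2 ℕ.≤? Vec.lookup e j₀

      term-affine : ∀ a e {k} → (∀ x → ⟦ e ⟧ₘ (ρ x) ≈ x ^ k * ⟦ e ⟧ₘ (ρ 1#)) → k ℕ.< 2 →
                    Affine (λ x → a * ⟦ e ⟧ₘ (ρ x))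
      term-affine a e {k} factor k<2 = Affine-resp
        (λ x → sym (trans (*-congˡ (factor x)) (solve 3 (λ a p m → a :* (p :* m) := p :* (a :* m)) refl _ _ _)))
        (Affine-scale k (a * ⟦ e ⟧ₘ (ρ 1#)) k<2)

      low-affine : ∀ q → Affine (λ x → ⟦ select (¬? ∘ high?) q ⟧ (ρ x))
      low-affine []            x = sym (trans (+-congˡ (trans (*-congˡ (-‿inverseʳ 0#)) (zeroʳ x))) (+-identityʳ 0#))
      low-affine ((a , e) ∷ q) with Vec.lookup e j₀ | ⟦⟧ₘ-factor e
      ... | 0           | factor = Affine-+ (term-affine a e factor (s≤s z≤n)) (low-affine q)
      ... | 1           | factor = Affine-+ (term-affine a e factor (s≤s (s≤s z≤n))) (low-affine q)
      ... | suc (suc _) | _      = low-affine q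

    degree≤1⇒affine : ∀ C → (∀ e → 2 ≤ Vec.lookup e j₀ → coeff C e ≈ 0#) → Affine (λ x → ⟦ C ⟧ (ρ x))
    degree≤1⇒affine C high≈0 = Affine-resp C-low (low-affine C)
      where
      C-low : ∀ x → ⟦ select (¬? ∘ high?) C ⟧ (ρ x) ≈ ⟦ C ⟧ (ρ x)
      C-low x = sym (begin
        ⟦ C ⟧ (ρ x)
          ≈⟨ ⟦⟧-select-split high? C (ρ x) ⟩
        ⟦ select high? C ⟧ (ρ x) + ⟦ select (¬? ∘ high?) C ⟧ (ρ x)
          ≈⟨ +-congʳ (vanishing⇒⟦⟧≈0 (select high? C) high-part≈0 (ρ x)) ⟩
        0# + ⟦ select (¬? ∘ high?) C ⟧ (ρ x)
          ≈⟨ +-identityˡ _ ⟩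
        ⟦ select (¬? ∘ high?) C ⟧ (ρ x) ∎)
        where
        high-part≈0 : ∀ e → coeff (select high? C) e ≈ 0#
        high-part≈0 e with high? e
        ... | yes high = trans (coeff-select high? C e high) (high≈0 e high)
        ... | no  low  = coeff-select-¬ high? C e low

module BooleanVectors where

  open import Data.Nat using (zero; suc; _^_)
  open import Data.Fin as Fin using (Fin; zero; suc; remQuot; combine)
  import Data.Fin.Properties as FinP
  open import Data.Vec as Vec using (Vec; []; _∷_)
  open import Data.Vec.Properties using (∷-injectiveˡ; ∷-injectiveʳ)
  open import Data.Bool using (Bool; true; false; not; _∧_; T)
  import Data.Bool.Properties as Bool
  open import Data.Bool.ListAction using (all)
  import Data.List as List
  open import Data.Unit using (tt)
  open import Function using (_∘_)
  open import Function.Bundles using (_⇔_; mk⇔; Equivalence)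
  open import Relation.Nullary using (contradiction)
  open import Data.Product using (_,_; proj₁; proj₂; uncurry)
  open import Relation.Binary.PropositionalEquality as ≡ using (_≡_)

  bit : Fin 2 → Bool
  bit zero    = false
  bit (suc _) = true

  bit-injective : ∀ {a b} → bit a ≡ bit b → a ≡ b
  bit-injective {zero}        {zero}        _ = ≡.refl
  bit-injective {suc zero}    {suc zero}    _ = ≡.refl
  bit-injective {zero}        {suc _}       ()
  bit-injective {suc _}       {zero}        ()

  binary : ∀ n → Fin (2 ^ n) → Vec Bool n
  binary zero    _ = []
  binary (suc n) i = bit (proj₁ (remQuot {2} (2 ^ n) i)) ∷ binary n (proj₂ (remQuot {2} (2 ^ n) i))

  binary-injective : ∀ n {i j} → binary n i ≡ binary n j → i ≡ j
  binary-injective zero    {zero} {zero} _ = ≡.refl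
  binary-injective (suc n) {i}    {j}    eq = begin
    i                                  ≡⟨ FinP.combine-remQuot {2} (2 ^ n) i ⟨
    uncurry combine (remQuot {2} (2 ^ n) i)
      ≡⟨ ≡.cong₂ combine (bit-injective (∷-injectiveˡ eq)) (binary-injective n (∷-injectiveʳ eq)) ⟩
    uncurry combine (remQuot {2} (2 ^ n) j) ≡⟨ FinP.combine-remQuot {2} (2 ^ n) j ⟩
    j                                  ∎
    where open ≡.≡-Reasoning

  disjoint : ∀ {n} → Vec Bool n → Vec Bool n → Bool
  disjoint []      []      = true
  disjoint (a ∷ α) (b ∷ β) = not (a ∧ b) ∧ disjoint α β

  T-disjoint : ∀ {k} (α β : Vec Bool k) → T (disjoint α β) ⇔ (∀ i → T (not (Vec.lookup α i ∧ Vec.lookup β i)))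
  T-disjoint []      []      = mk⇔ (λ _ ()) (λ _ → tt)
  T-disjoint (a ∷ α) (b ∷ β) = mk⇔
    (λ t → λ { zero    → proj₁ (Equivalence.to Bool.T-∧ t)
             ; (suc i) → Equivalence.to (T-disjoint α β) (proj₂ (Equivalence.to Bool.T-∧ t)) i })
    (λ t → Equivalence.from Bool.T-∧ (t zero , Equivalence.from (T-disjoint α β) (t ∘ suc)))

  T-all-tabulate : ∀ {m} {A : Set} (f : A → Bool) (g : Fin m → A) →
                   T (all f (List.tabulate g)) ⇔ (∀ i → T (f (g i)))
  T-all-tabulate {zero}  f g = mk⇔ (λ _ ()) (λ _ → tt)
  T-all-tabulate {suc m} f g = mk⇔
    (λ t → λ { zero    → proj₁ (Equivalence.to Bool.T-∧ t)
             ; (suc i) → Equivalence.to (T-all-tabulate f (g ∘ suc)) (proj₂ (Equivalence.to Bool.T-∧ t)) i })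
    (λ t → Equivalence.from Bool.T-∧ (t zero , Equivalence.from (T-all-tabulate f (g ∘ suc)) (t ∘ suc)))

  T-ext : ∀ {x y} → (T x → T y) → (T y → T x) → x ≡ y
  T-ext {false} {false} _ _ = ≡.refl
  T-ext {false} {true}  _ g = contradiction (g tt) λ ()
  T-ext {true}  {false} f _ = contradiction (f tt) λ ()
  T-ext {true}  {true}  _ _ = ≡.refl

module LinearAlgebra {c ℓ} (F : CommutativeRing c ℓ) where

  open import Data.Nat as ℕ using (ℕ; zero; suc; _≤_; z≤n; s≤s; _^_)
  import Data.Nat.Properties as ℕ
  open import Data.Fin as Fin using (Fin; zero; suc; punchIn)
  import Data.Fin.Properties as FinP
  open import Data.Bool as Bool using (Bool; true; false; if_then_else_; not; _∧_)
  import Data.Bool.Properties as Bool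
  open import Data.Vec using (Vec; []; _∷_)
  open import Data.Vec.Properties using (≡-dec)
  open BooleanVectors using (binary; binary-injective; disjoint)
  open import Data.Product using (∃; _,_; proj₁; proj₂)
  open import Data.Sum using (_⊎_; inj₁; inj₂)
  open import Relation.Nullary using (¬_; yes; no; does; contradiction)
  open import Relation.Nullary.Decidable using (decidable-stable; dec-true)
  open import Relation.Binary.PropositionalEquality as ≡ using (_≡_; _≢_)
  open import Function using (_∘_)
  import Algebra.Properties.Ring
  import Algebra.Properties.Semiring.Sum
  import Relation.Binary.Reasoning.Setoid

  open CommutativeRing F hiding (zero)
  open Algebra.Properties.Ring ring using (-0#≈0#)
  open Algebra.Properties.Semiring.Sum semiring using (sum; sum-syntax; sum-cong-≋; ∑-distrib-+; *-distribˡ-sum)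
  open IntegerSolver F using (solve; _:=_; _:+_; _:*_; :-_; _:-_; :0; :1)
  open Relation.Binary.Reasoning.Setoid setoid

  𝟙 : Bool → Carrier
  𝟙 b = if b then 1# else 0#

  𝟙-∧ : ∀ a b → 𝟙 (a ∧ b) ≈ 𝟙 a * 𝟙 b
  𝟙-∧ false b = sym (zeroˡ _)
  𝟙-∧ true  b = sym (*-identityˡ _)

  δ : ∀ {N} → Fin N → Fin N → Carrier
  δ r c = 𝟙 (does (r Fin.≟ c))

  δ-refl : ∀ {N} (r : Fin N) → δ r r ≈ 1#
  δ-refl r with r Fin.≟ r
  ... | yes _   = refl
  ... | no  r≢r = contradiction ≡.refl r≢r

  δ-≢ : ∀ {N} {r c : Fin N} → r ≢ c → δ r c ≈ 0#
  δ-≢ {r = r} {c} r≢c with r Fin.≟ c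
  ... | yes r≡c = contradiction r≡c r≢c
  ... | no  _   = refl

  δ-punchIn : ∀ {N} (i : Fin (suc N)) (r c : Fin N) → δ (punchIn i r) (punchIn i c) ≈ δ r c
  δ-punchIn i r c with r Fin.≟ c
  ... | yes ≡.refl = δ-refl (punchIn i r)
  ... | no  r≢c    = δ-≢ (r≢c ∘ FinP.punchIn-injective i r c)

  ¬¬-all⊎counterexample : ∀ {p} N (Q : Fin N → Set p) → ¬ ¬ ((∀ r → Q r) ⊎ ∃ λ r → ¬ Q r)
  ¬¬-all⊎counterexample zero    Q k = k (inj₁ λ ())
  ¬¬-all⊎counterexample (suc N) Q k = ¬¬-all⊎counterexample N (Q ∘ suc) λ
    { (inj₂ (r , ¬Qr)) → k (inj₂ (suc r , ¬Qr))
    ; (inj₁ all)       → k (inj₂ (zero , λ Q₀ → k (inj₁ λ { zero → Q₀ ; (suc r) → all r }))) }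

  ∑ᵇ : ∀ n → (Vec Bool n → Carrier) → Carrier
  ∑ᵇ zero    f = f []
  ∑ᵇ (suc n) f = ∑ᵇ n (f ∘ (false ∷_)) + ∑ᵇ n (f ∘ (true ∷_))

  ∑ᵇ-cong : ∀ n {f g : Vec Bool n → Carrier} → (∀ β → f β ≈ g β) → ∑ᵇ n f ≈ ∑ᵇ n g
  ∑ᵇ-cong zero    f≈g = f≈g []
  ∑ᵇ-cong (suc n) f≈g = +-cong (∑ᵇ-cong n (f≈g ∘ (false ∷_))) (∑ᵇ-cong n (f≈g ∘ (true ∷_)))

  *-distribˡ-∑ᵇ : ∀ n x (f : Vec Bool n → Carrier) → x * ∑ᵇ n f ≈ ∑ᵇ n (λ β → x * f β)
  *-distribˡ-∑ᵇ zero    x f = refl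
  *-distribˡ-∑ᵇ (suc n) x f = trans (distribˡ _ _ _) (+-cong (*-distribˡ-∑ᵇ n x _) (*-distribˡ-∑ᵇ n x _))

  ∑-∑ᵇ-comm : ∀ w n (f : Fin w → Vec Bool n → Carrier) →
              ∑[ k < w ] ∑ᵇ n (f k) ≈ ∑ᵇ n (λ β → ∑[ k < w ] f k β)
  ∑-∑ᵇ-comm w zero    f = refl
  ∑-∑ᵇ-comm w (suc n) f = trans (∑-distrib-+ {w} (λ k → ∑ᵇ n (f k ∘ (false ∷_))) _)
                                (+-cong (∑-∑ᵇ-comm w n _) (∑-∑ᵇ-comm w n _))

  -- the inverse of the 2 × 2 disjointness matrix 𝟙 (not (a ∧ b)) = [[1, 1], [1, 0]] ...
  disjointness⁻¹₁ : Bool → Bool → Carrier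
  disjointness⁻¹₁ false false = 0#
  disjointness⁻¹₁ false true  = 1#
  disjointness⁻¹₁ true  false = 1#
  disjointness⁻¹₁ true  true  = - 1#

  -- ... tensored n times
  disjointness⁻¹ : ∀ {n} → Vec Bool n → Vec Bool n → Carrier
  disjointness⁻¹ []      []      = 1#
  disjointness⁻¹ (a ∷ α) (b ∷ β) = disjointness⁻¹₁ a b * disjointness⁻¹ α β

  disjointness⁻¹₁-inverse : ∀ a c → disjointness⁻¹₁ a false * 𝟙 (not (false ∧ c))
                                    + disjointness⁻¹₁ a true * 𝟙 (not (true ∧ c)) ≈ 𝟙 (does (a Bool.≟ c))
  disjointness⁻¹₁-inverse false false = solve 0 (:0 :* :1 :+ :1 :* :1 := :1) refl
  disjointness⁻¹₁-inverse false true  = solve 0 (:0 :* :1 :+ :1 :* :0 := :0) refl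
  disjointness⁻¹₁-inverse true  false = solve 0 (:1 :* :1 :+ (:- :1) :* :1 := :0) refl
  disjointness⁻¹₁-inverse true  true  = solve 0 (:1 :* :1 :+ (:- :1) :* :0 := :1) refl

  disjointness⁻¹-inverse : ∀ n (α γ : Vec Bool n) →
    ∑ᵇ n (λ β → disjointness⁻¹ α β * 𝟙 (disjoint β γ)) ≈ 𝟙 (does (≡-dec Bool._≟_ α γ))
  disjointness⁻¹-inverse zero    []      []      = *-identityˡ 1#
  disjointness⁻¹-inverse (suc n) (a ∷ α) (c ∷ γ) = begin
    ∑ᵇ n (summand false) + ∑ᵇ n (summand true) ≈⟨ +-cong (factor false) (factor true) ⟩
    m false * S + m true * S                   ≈⟨ distribʳ S (m false) (m true) ⟨
    (m false + m true) * S
      ≈⟨ *-cong (disjointness⁻¹₁-inverse a c) (disjointness⁻¹-inverse n α γ) ⟩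
    𝟙 (does (a Bool.≟ c)) * 𝟙 (does (≡-dec Bool._≟_ α γ)) ≈⟨ 𝟙-∧ _ _ ⟨
    𝟙 (does (≡-dec Bool._≟_ (a ∷ α) (c ∷ γ)))  ∎
    where
    summand : Bool → Vec Bool n → Carrier
    summand b β = disjointness⁻¹ (a ∷ α) (b ∷ β) * 𝟙 (disjoint (b ∷ β) (c ∷ γ))

    S = ∑ᵇ n (λ β → disjointness⁻¹ α β * 𝟙 (disjoint β γ))

    m : Bool → Carrier
    m b = disjointness⁻¹₁ a b * 𝟙 (not (b ∧ c))

    factor : ∀ b → ∑ᵇ n (summand b) ≈ m b * S
    factor b = trans (∑ᵇ-cong n λ β → trans (*-congˡ (𝟙-∧ _ _))
                       (solve 4 (λ e d f g → (e :* d) :* (f :* g) := (e :* f) :* (d :* g)) refl _ _ _ _))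
                     (sym (*-distribˡ-∑ᵇ n (m b) _))

  module _ (isField : IsField F) where
    open IsField isField

    -- Gaussian elimination on the first column of X: either it vanishes, or a row with a nonzero
    -- entry is used as a pivot and removed.  Equality in F need not be decidable; the case split is
    -- justified because the conclusion is decidable.
    identity-factorisation⇒≤ : ∀ {w N} (X : Fin N → Fin w → Carrier) (Y : Fin w → Fin N → Carrier) →
                                (∀ r c → ∑[ k < w ] (X r k * Y k c) ≈ δ r c) → N ≤ w
    identity-factorisation⇒≤ {zero}  {zero}  X Y XY≈I = z≤n
    identity-factorisation⇒≤ {zero}  {suc N} X Y XY≈I =
      contradiction (sym (trans (XY≈I zero zero) (δ-refl {suc N} zero))) 1≉0
    identity-factorisation⇒≤ {suc w} {zero}  X Y XY≈I = z≤n
    identity-factorisation⇒≤ {suc w} {suc N} X Y XY≈I = s≤s (decidable-stable (N ℕ.≤? w)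
      (λ N≰w → ¬¬-all⊎counterexample (suc N) (λ r → x r ≈ 0#) λ
        { (inj₁ column≈0)    → N≰w (ℕ.≤-pred (ℕ.m≤n⇒m≤1+n (first-column-zero column≈0)))
        ; (inj₂ (i , xᵢ≉0)) → N≰w (pivot i xᵢ≉0) }))
      where
      x : Fin (suc N) → Carrier
      x r = X r zero

      y : Fin (suc N) → Carrier
      y c = Y zero c

      X′ : Fin (suc N) → Fin w → Carrier
      X′ r k = X r (suc k)

      Y′ : Fin w → Fin (suc N) → Carrier
      Y′ k c = Y (suc k) c

      X′Y′≈I-xy : ∀ r c → ∑[ k < w ] (X′ r k * Y′ k c) ≈ δ r c - x r * y c
      X′Y′≈I-xy r c = begin
        ∑[ k < w ] (X′ r k * Y′ k c)                              ≈⟨ solve 2 (λ s t → s := (t :+ s) :- t) refl _ _ ⟩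
        (x r * y c + ∑[ k < w ] (X′ r k * Y′ k c)) - x r * y c    ≈⟨ +-congʳ (XY≈I r c) ⟩
        δ r c - x r * y c                                         ∎

      first-column-zero : (∀ r → x r ≈ 0#) → suc N ≤ w
      first-column-zero column≈0 = identity-factorisation⇒≤ X′ Y′ λ r c → begin
        ∑[ k < w ] (X′ r k * Y′ k c) ≈⟨ X′Y′≈I-xy r c ⟩
        δ r c - x r * y c            ≈⟨ +-congˡ (-‿cong (trans (*-congʳ (column≈0 r)) (zeroˡ _))) ⟩
        δ r c - 0#                   ≈⟨ +-congˡ -0#≈0# ⟩
        δ r c + 0#                   ≈⟨ +-identityʳ _ ⟩
        δ r c                        ∎

      pivot : ∀ i → ¬ x i ≈ 0# → N ≤ w
      pivot i xᵢ≉0 = identity-factorisation⇒≤ X″ Y″ X″Y″≈I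
        where
        u = proj₁ (invert (x i) xᵢ≉0)
        xᵢu≈1 = proj₂ (invert (x i) xᵢ≉0)

        X″ : Fin N → Fin w → Carrier
        X″ r k = X′ (punchIn i r) k - (x (punchIn i r) * u) * X′ i k

        Y″ : Fin w → Fin N → Carrier
        Y″ k c = Y′ k (punchIn i c)

        X″Y″≈I : ∀ r c → ∑[ k < w ] (X″ r k * Y″ k c) ≈ δ r c
        X″Y″≈I r c = begin
          ∑[ k < w ] (X″ r k * Y″ k c)
            ≈⟨ sum-cong-≋ {w} (λ k →
                 solve 4 (λ a s b d → (a :- s :* b) :* d := a :* d :+ (:- s) :* (b :* d)) refl _ _ _ _) ⟩
          ∑[ k < w ] (X′ r′ k * Y′ k c′ + (- s) * (X′ i k * Y′ k c′))
            ≈⟨ ∑-distrib-+ {w} (λ k → X′ r′ k * Y′ k c′) _ ⟩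
          ∑[ k < w ] (X′ r′ k * Y′ k c′) + ∑[ k < w ] ((- s) * (X′ i k * Y′ k c′))
            ≈⟨ +-cong (X′Y′≈I-xy r′ c′)
                      (trans (sym (*-distribˡ-sum {w} (- s) (λ k → X′ i k * Y′ k c′))) (*-congˡ (X′Y′≈I-xy i c′))) ⟩
          (δ r′ c′ - x r′ * y c′) + (- s) * (δ i c′ - x i * y c′)
            ≈⟨ +-cong (+-congʳ (δ-punchIn i r c)) (*-congˡ (+-congʳ (δ-≢ (FinP.punchInᵢ≢i i c ∘ ≡.sym)))) ⟩
          (δ r c - x r′ * y c′) + (- s) * (0# - x i * y c′)
            ≈⟨ solve 5 (λ d a b xᵢ u → (d :- a :* b) :+ (:- (a :* u)) :* (:0 :- xᵢ :* b)
                                      := d :+ a :* b :* (xᵢ :* u :- :1)) refl (δ r c) (x r′) (y c′) (x i) u ⟩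
          δ r c + x r′ * y c′ * (x i * u - 1#)
            ≈⟨ +-congˡ (trans (*-congˡ (trans (+-congʳ xᵢu≈1) (-‿inverseʳ 1#))) (zeroʳ _)) ⟩
          δ r c + 0#
            ≈⟨ +-identityʳ _ ⟩
          δ r c ∎
          where
          r′ = punchIn i r
          c′ = punchIn i c
          s  = x r′ * u

    disjointness-rank : ∀ n w (U : Vec Bool n → Fin w → Carrier) (V : Fin w → Vec Bool n → Carrier) →
                        (∀ α β → 𝟙 (disjoint α β) ≈ ∑[ k < w ] (U α k * V k β)) → 2 ^ n ≤ w
    disjointness-rank n w U V D≈UV = identity-factorisation⇒≤ X Y XY≈I
      where
      X : Fin (2 ^ n) → Fin w → Carrier
      X r k = ∑ᵇ n (λ β → disjointness⁻¹ (binary n r) β * U β k)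

      Y : Fin w → Fin (2 ^ n) → Carrier
      Y k c = V k (binary n c)

      binary-δ : ∀ r c → 𝟙 (does (≡-dec Bool._≟_ (binary n r) (binary n c))) ≈ δ r c
      binary-δ r c with r Fin.≟ c
      ... | yes ≡.refl = reflexive (≡.cong 𝟙 (dec-true (≡-dec Bool._≟_ (binary n r) (binary n r)) ≡.refl))
      ... | no  r≢c with ≡-dec Bool._≟_ (binary n r) (binary n c)
      ...   | yes eq = contradiction (binary-injective n eq) r≢c
      ...   | no  _  = refl

      XY≈I : ∀ r c → ∑[ k < w ] (X r k * Y k c) ≈ δ r c
      XY≈I r c = begin
        ∑[ k < w ] (X r k * Y k c)
          ≈⟨ sum-cong-≋ {w} (λ k → trans (*-comm _ _) (*-distribˡ-∑ᵇ n _ _)) ⟩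
        ∑[ k < w ] ∑ᵇ n (λ β → Y k c * (disjointness⁻¹ (binary n r) β * U β k))
          ≈⟨ ∑-∑ᵇ-comm w n _ ⟩
        ∑ᵇ n (λ β → ∑[ k < w ] (Y k c * (disjointness⁻¹ (binary n r) β * U β k)))
          ≈⟨ ∑ᵇ-cong n (λ β → trans (sum-cong-≋ {w} (λ k → solve 3 (λ y d u → y :* (d :* u) := d :* (u :* y)) refl _ _ _))
                                     (sym (*-distribˡ-sum {w} _ _))) ⟩
        ∑ᵇ n (λ β → disjointness⁻¹ (binary n r) β * ∑[ k < w ] (U β k * Y k c))
          ≈⟨ ∑ᵇ-cong n (λ β → *-congˡ (D≈UV β (binary n c))) ⟨
        ∑ᵇ n (λ β → disjointness⁻¹ (binary n r) β * 𝟙 (disjoint β (binary n c)))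
          ≈⟨ disjointness⁻¹-inverse n (binary n r) (binary n c) ⟩
        𝟙 (does (≡-dec Bool._≟_ (binary n r) (binary n c)))
          ≈⟨ binary-δ r c ⟩
        δ r c ∎

module BranchingPrograms {c ℓ} (F : CommutativeRing c ℓ) where

  open import Level using (_⊔_)
  open import Data.Nat as ℕ using (ℕ; zero; suc; _≤_; _<_; _∸_; z≤n; s≤s)
  import Data.Nat.Properties as ℕ
  open import Data.Fin using (Fin; zero; suc; toℕ)
  open import Data.List using ([]; _∷_; length)
  open import Relation.Nullary using (¬_; yes; no; contradiction)
  open import Relation.Binary.PropositionalEquality as ≡ using (_≡_)
  open import Function using (_∘_)
  import Algebra.Properties.Semiring.Sum
  import Relation.Binary.Reasoning.Setoid

  open CommutativeRing F hiding (zero)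
  open Poly F
  open Evaluation F using (⟦_⟧; _≋_; horner; ⟦⟧-const; ⟦⟧-*P; ⟦⟧-uni; ⟦⟧-sumFin)
  open LinearAlgebra F using (δ; δ-≢)
  open Algebra.Properties.Semiring.Sum semiring
    using (sum; sum-syntax; sum-cong-≋; sum-replicate-zero; ∑-comm; *-distribˡ-sum; *-distribʳ-sum)
  open Relation.Binary.Reasoning.Setoid setoid

  value : ∀ {w k} → ABP w k → (Fin k → Carrier) → Fin w → Carrier
  value done                     a i = 1#
  value (layer {w₁ = w₁} L rest) a i = ∑[ b < w₁ ] (horner (L i b) (a zero) * value rest (a ∘ suc) b)

  ⟦⟧-evalABP : ∀ {M w k} (x : Fin k → Fin M) (A : ABP w k) i ρ → ⟦ evalABP x A i ⟧ ρ ≈ value A (ρ ∘ x) i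
  ⟦⟧-evalABP x done                     i ρ = ⟦⟧-const 1# ρ
  ⟦⟧-evalABP x (layer {w₁ = w₁} L rest) i ρ = trans (⟦⟧-sumFin w₁ _ ρ) (sum-cong-≋ {w₁} λ b →
    trans (⟦⟧-*P (uni (x zero) (L i b)) _ ρ) (*-cong (⟦⟧-uni (x zero) (L i b) ρ) (⟦⟧-evalABP (x ∘ suc) rest b ρ)))

  horner-cong : ∀ as {x y} → x ≈ y → horner as x ≈ horner as y
  horner-cong []       x≈y = refl
  horner-cong (a ∷ as) x≈y = +-congˡ (*-cong x≈y (horner-cong as x≈y))

  value-cong : ∀ {w k} (A : ABP w k) {a a′} → a ≋ a′ → ∀ i → value A a i ≈ value A a′ i
  value-cong done                     a≋a′ i = refl
  value-cong (layer {w₁ = w₁} L rest) a≋a′ i = sum-cong-≋ {w₁} λ b →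
    *-cong (horner-cong (L i b) (a≋a′ zero)) (value-cong rest (a≋a′ ∘ suc) b)

  source-width≤width : ∀ {w k} (A : ABP w k) → w ≤ widthABP A
  source-width≤width done           = ℕ.≤-refl
  source-width≤width (layer L rest) = ℕ.m≤m⊔n _ _

  splice : ∀ {a} {A : Set a} {k} → ℕ → (Fin k → A) → (Fin k → A) → Fin k → A
  splice zero    f g t       = g t
  splice (suc P) f g zero    = f zero
  splice (suc P) f g (suc t) = splice P (f ∘ suc) (g ∘ suc) t

  splice-< : ∀ {a} {A : Set a} {k} P (f g : Fin k → A) t → toℕ t < P → splice P f g t ≡ f t
  splice-< (suc P) f g zero    _         = ≡.refl
  splice-< (suc P) f g (suc t) (s≤s t<P) = splice-< P (f ∘ suc) (g ∘ suc) t t<P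

  splice-≥ : ∀ {a} {A : Set a} {k} P (f g : Fin k → A) t → ¬ toℕ t < P → splice P f g t ≡ g t
  splice-≥ zero    f g t       _   = ≡.refl
  splice-≥ (suc P) f g zero    t≮P = contradiction (s≤s z≤n) t≮P
  splice-≥ (suc P) f g (suc t) t≮P = splice-≥ P (f ∘ suc) (g ∘ suc) t (t≮P ∘ s≤s)

  splice-cases : ∀ {a} {A : Set a} {k} P (f g : Fin k → A) t {x} →
                 (toℕ t < P → x ≡ f t) → (¬ toℕ t < P → x ≡ g t) → x ≡ splice P f g t
  splice-cases P f g t before after with toℕ t ℕ.<? P
  ... | yes t<P = ≡.trans (before t<P) (≡.sym (splice-< P f g t t<P))
  ... | no  t≮P = ≡.trans (after t≮P) (≡.sym (splice-≥ P f g t t≮P))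

  -- Cutting the program at layer P: the first P layers only see the first P inputs, the others only
  -- the remaining ones, and all paths pass through the at most `widthABP A` nodes of layer P.
  record Factorisation {w k} (A : ABP w k) (P : ℕ) : Set (c ⊔ ℓ) where
    field
      cutWidth   : ℕ
      cutWidth≤  : cutWidth ≤ widthABP A
      prefix     : (Fin k → Carrier) → Fin w → Fin cutWidth → Carrier
      suffix     : (Fin k → Carrier) → Fin cutWidth → Carrier
      value≈∑    : ∀ f g i → value A (splice P f g) i ≈ ∑[ b < cutWidth ] (prefix f i b * suffix g b)

  factorise : ∀ {w k} (A : ABP w k) P → Factorisation A P
  factorise {w} A zero = record
    { cutWidth = w ; cutWidth≤ = source-width≤width A ; prefix = λ _ → δ ; suffix = value A
    ; value≈∑ = λ f g i → sym (∑-δ i (value A g)) }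
    where
    ∑-δ : ∀ {w} (i : Fin w) (h : Fin w → Carrier) → ∑[ b < w ] (δ i b * h b) ≈ h i
    ∑-δ {suc w} zero    h = begin
      δ {suc w} zero zero * h zero + ∑[ b < w ] (δ zero (suc b) * h (suc b))
        ≈⟨ +-cong (*-identityˡ _) (sum-cong-≋ {w} λ b → trans (*-congʳ (δ-≢ {r = zero} {suc b} λ ())) (zeroˡ _)) ⟩
      h zero + ∑[ b < w ] 0#                                         ≈⟨ +-congˡ (sum-replicate-zero w) ⟩
      h zero + 0#                                                    ≈⟨ +-identityʳ _ ⟩
      h zero                                                         ∎
    ∑-δ {suc w} (suc i) h = begin
      δ (suc i) zero * h zero + ∑[ b < w ] (δ i b * h (suc b))
        ≈⟨ +-cong (trans (*-congʳ (δ-≢ {r = suc i} {zero} λ ())) (zeroˡ _)) (∑-δ i (h ∘ suc)) ⟩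
      0# + h (suc i)                                           ≈⟨ +-identityˡ _ ⟩
      h (suc i)                                                ∎
  factorise done (suc P) = record
    { cutWidth = 1 ; cutWidth≤ = ℕ.≤-refl ; prefix = λ _ _ _ → 1# ; suffix = λ _ _ → 1#
    ; value≈∑ = λ f g i → sym (trans (+-identityʳ _) (*-identityˡ 1#)) }
  factorise (layer {w₀} {w₁} L rest) (suc P) = record
    { cutWidth  = cutWidth
    ; cutWidth≤ = ℕ.≤-trans cutWidth≤ (ℕ.m≤n⊔m w₀ _)
    ; prefix    = λ f i b′ → ∑[ b < w₁ ] (horner (L i b) (f zero) * prefix (f ∘ suc) b b′)
    ; suffix    = λ g → suffix (g ∘ suc)
    ; value≈∑   = λ f g i → begin
        ∑[ b < w₁ ] (horner (L i b) (f zero) * value rest (splice P (f ∘ suc) (g ∘ suc)) b)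
          ≈⟨ sum-cong-≋ {w₁} (λ b → trans (*-congˡ (value≈∑ (f ∘ suc) (g ∘ suc) b))
                                          (*-distribˡ-sum {cutWidth} _ _)) ⟩
        ∑[ b < w₁ ] ∑[ b′ < cutWidth ] (horner (L i b) (f zero) * (prefix (f ∘ suc) b b′ * suffix (g ∘ suc) b′))
          ≈⟨ ∑-comm {w₁} {cutWidth} _ ⟩
        ∑[ b′ < cutWidth ] ∑[ b < w₁ ] (horner (L i b) (f zero) * (prefix (f ∘ suc) b b′ * suffix (g ∘ suc) b′))
          ≈⟨ sum-cong-≋ {cutWidth} (λ b′ → trans (sum-cong-≋ {w₁} (λ b → sym (*-assoc _ _ _)))
                                                 (sym (*-distribʳ-sum {w₁} _ _))) ⟩
        ∑[ b′ < cutWidth ] (∑[ b < w₁ ] (horner (L i b) (f zero) * prefix (f ∘ suc) b b′) * suffix (g ∘ suc) b′) ∎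
    }
    where open Factorisation (factorise rest P)

  ≤-maxFin : ∀ n (f : Fin n → ℕ) i → f i ≤ maxFin n f
  ≤-maxFin (suc n) f zero    = ℕ.m≤m⊔n _ _
  ≤-maxFin (suc n) f (suc i) = ℕ.≤-trans (≤-maxFin n (f ∘ suc) i) (ℕ.m≤n⊔m _ _)

  value-constant : ∀ {w k} (A : ABP w k) → degABP A ≡ 0 → ∀ a a′ i → value A a i ≈ value A a′ i
  value-constant done                          _    a a′ i = refl
  value-constant (layer {w₀} {w₁} L rest) deg≡0 a a′ i = sum-cong-≋ {w₁} λ b →
    *-cong (horner-constant (L i b) (ℕ.n≤0⇒n≡0 (label-degree≤0 b)))
           (value-constant rest (ℕ.n≤0⇒n≡0 (ℕ.≤-trans (ℕ.m≤n⊔m _ _) (ℕ.≤-reflexive deg≡0))) (a ∘ suc) (a′ ∘ suc) b)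
    where
    label-degree≤0 : ∀ b → length (L i b) ∸ 1 ≤ 0
    label-degree≤0 b = ℕ.≤-trans (≤-maxFin w₁ _ b)
                        (ℕ.≤-trans (≤-maxFin w₀ (λ i → maxFin w₁ (λ b → length (L i b) ∸ 1)) i)
                          (ℕ.≤-trans (ℕ.m≤m⊔n _ _) (ℕ.≤-reflexive deg≡0)))

    horner-constant : ∀ as → length as ∸ 1 ≡ 0 → horner as (a zero) ≈ horner as (a′ zero)
    horner-constant []           _ = refl
    horner-constant (_ ∷ [])     _ = +-congˡ (trans (zeroʳ _) (sym (zeroʳ _)))
    horner-constant (_ ∷ _ ∷ _) ()

module Counting where

  open import Data.Nat as ℕ using (ℕ; zero; suc; _+_; _≤_; _<_; z≤n; s≤s; _<ᵇ_; _≡ᵇ_)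
  import Data.Nat.Properties as ℕ
  open import Data.Fin using (Fin; zero; suc)
  import Data.Fin.Properties as FinP
  open import Data.Bool using (Bool; true; false; not; if_then_else_; T)
  open import Data.Product using (Σ; ∃; _×_; _,_; proj₁; proj₂)
  open import Data.Unit using (tt)
  open import Relation.Nullary using (¬_; yes; no; contradiction)
  open import Relation.Binary.PropositionalEquality as ≡ using (_≡_)
  open import Function using (_∘_)
  open import Function.Definitions using (Injective)
  open import Algebra.Properties.CommutativeSemigroup ℕ.+-commutativeSemigroup using (interchange)

  count : ∀ {k} → (Fin k → Bool) → ℕ
  count {zero}  Q = 0
  count {suc k} Q = (if Q zero then 1 else 0) + count (Q ∘ suc)

  count-none : ∀ {k} (Q : Fin k → Bool) → (∀ j → Q j ≡ false) → count Q ≡ 0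
  count-none {zero}  Q none = ≡.refl
  count-none {suc k} Q none rewrite none zero = count-none (Q ∘ suc) (none ∘ suc)

  count-all : ∀ {k} (Q : Fin k → Bool) → (∀ j → Q j ≡ true) → count Q ≡ k
  count-all {zero}  Q all = ≡.refl
  count-all {suc k} Q all rewrite all zero = ≡.cong suc (count-all (Q ∘ suc) (all ∘ suc))

  count+count-not : ∀ {k} (Q : Fin k → Bool) → count Q + count (not ∘ Q) ≡ k
  count+count-not {zero}  Q = ≡.refl
  count+count-not {suc k} Q with Q zero
  ... | true  = ≡.cong suc (count+count-not (Q ∘ suc))
  ... | false = ≡.trans (ℕ.+-suc _ _) (≡.cong suc (count+count-not (Q ∘ suc)))

  pick : ∀ {k} (Q : Fin k → Bool) n → n ≤ count Q →
         Σ (Fin n → Fin k) λ e → Injective _≡_ _≡_ e × (∀ i → Q (e i) ≡ true)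
  pick {zero}  Q zero    _ = (λ ()) , (λ {}) , (λ ())
  pick {suc k} Q n       n≤ with Q zero in Q₀
  pick {suc k} Q zero    _         | true = (λ ()) , (λ {}) , (λ ())
  pick {suc k} Q (suc n) (s≤s n≤)  | true with pick (Q ∘ suc) n n≤
  ... | e , e-injective , Qe = (λ { zero → zero ; (suc i) → suc (e i) })
                             , (λ { {zero} {zero} _ → ≡.refl
                                  ; {suc i} {suc j} eq → ≡.cong suc (e-injective (FinP.suc-injective eq)) })
                             , (λ { zero → Q₀ ; (suc i) → Qe i })
  pick {suc k} Q n       n≤        | false with pick (Q ∘ suc) n n≤
  ... | e , e-injective , Qe = suc ∘ e , e-injective ∘ FinP.suc-injective , Qe

  discrete-ivt : ∀ (f : ℕ → ℕ) n K → f 0 ≡ 0 → n ≤ f K → (∀ p → f (suc p) ≤ suc (f p)) →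
                 ∃ λ p → f p ≡ n
  discrete-ivt f n zero    f0≡0 n≤fK step = 0 , ≡.trans f0≡0 (≡.sym (ℕ.n≤0⇒n≡0 (≡.subst (n ≤_) f0≡0 n≤fK)))
  discrete-ivt f n (suc K) f0≡0 n≤fK step with n ℕ.≤? f K
  ... | yes n≤fK′ = discrete-ivt f n K f0≡0 n≤fK′ step
  ... | no  n≰fK′ = suc K , ℕ.≤-antisym (ℕ.≤-trans (step K) (ℕ.≰⇒> n≰fK′)) n≤fK

  private
    [_] : Bool → ℕ
    [ b ] = if b then 1 else 0

    count-split : ∀ {k} (Q R S : Fin k → Bool) → (∀ j → [ Q j ] ≡ [ R j ] + [ S j ]) → count Q ≡ count R + count S
    count-split {zero}  Q R S split = ≡.refl
    count-split {suc k} Q R S split =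
      ≡.trans (≡.cong₂ _+_ (split zero) (count-split (Q ∘ suc) (R ∘ suc) (S ∘ suc) (split ∘ suc)))
              (interchange [ R zero ] [ S zero ] (count (R ∘ suc)) (count (S ∘ suc)))

    <ᵇ-suc : ∀ x p → [ x <ᵇ suc p ] ≡ [ x <ᵇ p ] + [ x ≡ᵇ p ]
    <ᵇ-suc zero    zero    = ≡.refl
    <ᵇ-suc zero    (suc p) = ≡.refl
    <ᵇ-suc (suc x) zero    = ≡.refl
    <ᵇ-suc (suc x) (suc p) = <ᵇ-suc x p

    T-≡ : ∀ {b} → b ≡ true → T b
    T-≡ ≡.refl = tt

    ≡-T : ∀ {b} → T b → b ≡ true
    ≡-T {true} _ = ≡.refl

  hits≤1 : ∀ {k} (pos : Fin k → ℕ) → Injective _≡_ _≡_ pos → ∀ P → count (λ j → pos j ≡ᵇ P) ≤ 1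
  hits≤1 {zero}  pos pos-injective P = z≤n
  hits≤1 {suc k} pos pos-injective P with pos zero ≡ᵇ P in hit₀
  ... | true  = ℕ.≤-reflexive (≡.cong suc (count-none _ no-other-hit))
    where
    no-other-hit : ∀ j → (pos (suc j) ≡ᵇ P) ≡ false
    no-other-hit j with pos (suc j) ≡ᵇ P in hitⱼ
    ... | false = ≡.refl
    ... | true  = contradiction (pos-injective (≡.trans (ℕ.≡ᵇ⇒≡ _ _ (T-≡ hit₀)) (≡.sym (ℕ.≡ᵇ⇒≡ _ _ (T-≡ hitⱼ)))))
                                FinP.0≢1+n
  ... | false = hits≤1 (pos ∘ suc) (FinP.suc-injective ∘ pos-injective) P

  below-suc : ∀ {k} (pos : Fin k → ℕ) → Injective _≡_ _≡_ pos → ∀ P →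
              count (λ j → pos j <ᵇ suc P) ≤ suc (count (λ j → pos j <ᵇ P))
  below-suc pos pos-injective P = begin
    count (λ j → pos j <ᵇ suc P)                              ≡⟨ count-split _ _ _ (λ j → <ᵇ-suc (pos j) P) ⟩
    count (λ j → pos j <ᵇ P) + count (λ j → pos j ≡ᵇ P)       ≤⟨ ℕ.+-monoʳ-≤ _ (hits≤1 pos pos-injective P) ⟩
    count (λ j → pos j <ᵇ P) + 1                              ≡⟨ ℕ.+-comm _ 1 ⟩
    suc (count (λ j → pos j <ᵇ P))                            ∎
    where open ℕ.≤-Reasoning

  record BalancedCut (n : ℕ) (pos : Fin (2 ℕ.* n) → ℕ) : Set where
    field
      cut             : ℕ
      left right      : Fin n → Fin (2 ℕ.* n)
      left-injective  : Injective _≡_ _≡_ left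
      right-injective : Injective _≡_ _≡_ right
      left-<          : ∀ k → pos (left k) < cut
      right-≮         : ∀ k → ¬ pos (right k) < cut

  opaque
    balanced-cut : ∀ n K (pos : Fin (2 ℕ.* n) → ℕ) → Injective _≡_ _≡_ pos → (∀ j → pos j < K) →
                   BalancedCut n pos
    balanced-cut n K pos pos-injective pos<K = record
      { cut = cut ; left = proj₁ left ; right = proj₁ right
      ; left-injective = proj₁ (proj₂ left) ; right-injective = proj₁ (proj₂ right)
      ; left-< = λ k → ℕ.<ᵇ⇒< _ _ (T-≡ (proj₂ (proj₂ left) k))
      ; right-≮ = λ k → not-true (proj₂ (proj₂ right) k) ∘ ℕ.<⇒<ᵇ }
      where
      below : ℕ → ℕ
      below P = count (λ j → pos j <ᵇ P)

      balanced : ∃ λ P → below P ≡ n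
      balanced = discrete-ivt below n K (count-none (λ j → pos j <ᵇ 0) λ _ → ≡.refl)
                   (ℕ.≤-trans (ℕ.m≤m+n n (n + 0)) (ℕ.≤-reflexive (≡.sym (count-all _ λ j → ≡-T (ℕ.<⇒<ᵇ (pos<K j))))))
                   (below-suc pos pos-injective)
      cut : ℕ
      cut = proj₁ balanced

      Q : Fin (2 ℕ.* n) → Bool
      Q j = pos j <ᵇ cut

      left : Σ (Fin n → Fin (2 ℕ.* n)) λ e → Injective _≡_ _≡_ e × (∀ i → Q (e i) ≡ true)
      left = pick Q n (ℕ.≤-reflexive (≡.sym (proj₂ balanced)))

      count-not-Q : count (not ∘ Q) ≡ n
      count-not-Q = ℕ.+-cancelˡ-≡ n _ _ (≡.trans (≡.cong (_+ count (not ∘ Q)) (≡.sym (proj₂ balanced)))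
                                                  (≡.trans (count+count-not Q) (≡.cong (n +_) (ℕ.+-identityʳ n))))

      right : Σ (Fin n → Fin (2 ℕ.* n)) λ e → Injective _≡_ _≡_ e × (∀ i → not (Q (e i)) ≡ true)
      right = pick (not ∘ Q) n (ℕ.≤-reflexive (≡.sym count-not-Q))

      not-true : ∀ {b} → not b ≡ true → ¬ T b
      not-true {true} () _

module Instance {c ℓ} (F : CommutativeRing c ℓ) (n : ℕ) where

  open import Data.Nat as ℕ using (ℕ; zero)
  open import Data.Fin using (Fin; zero; splitAt; _↑ˡ_; _↑ʳ_)
  import Data.Fin.Properties as FinP
  open import Data.List as List using (List; []; _∷_)
  open import Data.Bool using (Bool; true; false; not; _∧_)
  open import Data.Bool.ListAction using (all)
  import Data.Bool.Properties as Bool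
  open import Data.Product using (_×_; _,_; proj₁; proj₂)
  open import Data.Sum using (inj₁; inj₂; [_,_]′)
  open import Relation.Binary.PropositionalEquality as ≡ using (_≡_; _≢_)
  open import Relation.Nullary using (contradiction)
  open import Function as Fun using (_∘_)
  import Algebra.Properties.Ring
  import Relation.Binary.Reasoning.Setoid

  open CommutativeRing F hiding (zero)
  open Poly F
  open Evaluation F
  open Algebra.Properties.Ring ring using (-0#≈0#)
  open LinearAlgebra F using (𝟙; 𝟙-∧)
  open IntegerSolver F using (solve; _:=_; _:+_; _:*_; :-_; _:-_; :0; :1; :2)
  open Relation.Binary.Reasoning.Setoid setoid

  N : ℕ
  N = NStar n

  M : ℕ
  M = N ℕ.+ (1 ℕ.+ N)

  t₀ : Fin M
  t₀ = tVar N 1 zero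

  -- the point (v, t, s) = (v, x, 0) of the refutation's variable space
  point : Assignment N → Carrier → Assignment M
  point v x = [ v , [ Fun.const x , Fun.const 0# ]′ ∘ splitAt 1 ]′ ∘ splitAt N

  point-t₀ : ∀ v x → point v x t₀ ≡ x
  point-t₀ v x = ≡.trans (≡.cong [ v , [ Fun.const x , Fun.const 0# ]′ ∘ splitAt 1 {N} ]′ (FinP.splitAt-↑ʳ N (1 ℕ.+ N) (zero {n = 0} ↑ˡ N)))
                         (≡.cong [ Fun.const x , Fun.const 0# ]′ (FinP.splitAt-↑ˡ 1 zero N))

  point-off : ∀ v x x′ y → y ≢ t₀ → point v x y ≡ point v x′ y
  point-off v x x′ y y≢t₀ with splitAt N y in y≡
  ... | inj₁ _ = ≡.refl
  ... | inj₂ z with splitAt 1 z in z≡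
  ...   | inj₂ _    = ≡.refl
  ...   | inj₁ zero = contradiction (≡.trans (≡.cong (N ↑ʳ_) (FinP.splitAt⁻¹-↑ˡ z≡)) (FinP.splitAt⁻¹-↑ʳ y≡)) (y≢t₀ ∘ ≡.sym)

  ⟦σ₀⟧≈point : ∀ v y → ⟦ σ₀ N 1 y ⟧ v ≈ point v 0# y
  ⟦σ₀⟧≈point v y with splitAt N y
  ... | inj₁ i = ⟦⟧-var i v
  ... | inj₂ z with splitAt 1 z
  ...   | inj₁ _ = refl
  ...   | inj₂ _ = refl

  Boolean : Assignment N → Set ℓ
  Boolean v = ∀ i → v i * v i ≈ v i

  ⟦σ₁⟧≈point : ∀ g v → Boolean v → ∀ y → ⟦ σ₁ N 1 g y ⟧ v ≈ point v (⟦ g zero ⟧ v) y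
  ⟦σ₁⟧≈point g v v-boolean y with splitAt N y
  ... | inj₁ i = ⟦⟧-var i v
  ... | inj₂ z with splitAt 1 z
  ...   | inj₁ zero = refl
  ...   | inj₂ i    = begin
    ⟦ (var i *P var i) -P var i ⟧ v    ≈⟨ ⟦⟧-subP (var i *P var i) (var i) v ⟩
    ⟦ var i *P var i ⟧ v - ⟦ var i ⟧ v
      ≈⟨ +-cong (trans (⟦⟧-*P (var i) (var i) v) (*-cong (⟦⟧-var i v) (⟦⟧-var i v))) (-‿cong (⟦⟧-var i v)) ⟩
    v i * v i - v i                    ≈⟨ +-congʳ (v-boolean i) ⟩
    v i - v i                          ≈⟨ -‿inverseʳ _ ⟩
    0#                                 ∎

  endpoints : Fin (mPairs n) → Fin (2 ℕ.* n) × Fin (2 ℕ.* n)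
  endpoints = List.lookup (pairs (2 ℕ.* n))

  edge : (Fin N → Bool) → Fin (mPairs n) → Bool
  edge b p = b (zVar n p) ∧ (b (xVar n (proj₁ (endpoints p))) ∧ b (xVar n (proj₂ (endpoints p))))

  -- the value of ∏_{i<j} (1 - z_{i,j} x_i x_j) at the Boolean point b
  independent : (Fin N → Bool) → Bool
  independent b = all (not ∘ edge b) (List.allFin (mPairs n))

  𝟙-boolean : ∀ b → Boolean (𝟙 ∘ b)
  𝟙-boolean b i = trans (sym (𝟙-∧ (b i) (b i))) (reflexive (≡.cong 𝟙 (Bool.∧-idem (b i))))

  ⟦fStar⟧ : ∀ b → ⟦ fStar n ⟧ (𝟙 ∘ b) ≈ 𝟙 (independent b) - (1# + 1#)
  ⟦fStar⟧ b = begin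
    ⟦ fStar n ⟧ (𝟙 ∘ b)                                      ≈⟨ ⟦⟧-substP (fPoly n) substitution (𝟙 ∘ b) ⟩
    ⟦ fPoly n ⟧ w                                            ≈⟨ ⟦⟧-subP (prodP (factors (List.allFin (mPairs n)))) two w ⟩
    ⟦ prodP (factors (List.allFin (mPairs n))) ⟧ w - ⟦ two ⟧ w
      ≈⟨ +-cong (⟦product⟧ (List.allFin (mPairs n))) (-‿cong (⟦⟧-const (1# + 1#) w)) ⟩
    𝟙 (independent b) - (1# + 1#)                            ∎
    where
    substitution : Fin (mPairs n) → Pol N
    substitution p = var (zVar n p) *P (var (xVar n (proj₁ (endpoints p))) *P var (xVar n (proj₂ (endpoints p))))

    w : Assignment (mPairs n)
    w p = ⟦ substitution p ⟧ (𝟙 ∘ b)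

    w≈edge : ∀ p → w p ≈ 𝟙 (edge b p)
    w≈edge p = begin
      ⟦ var z *P (var x *P var y) ⟧ (𝟙 ∘ b)      ≈⟨ ⟦⟧-*P (var z) (var x *P var y) (𝟙 ∘ b) ⟩
      ⟦ var z ⟧ (𝟙 ∘ b) * ⟦ var x *P var y ⟧ (𝟙 ∘ b)
        ≈⟨ *-cong (⟦⟧-var z (𝟙 ∘ b)) (trans (⟦⟧-*P (var x) (var y) (𝟙 ∘ b)) (*-cong (⟦⟧-var x (𝟙 ∘ b)) (⟦⟧-var y (𝟙 ∘ b)))) ⟩
      𝟙 (b z) * (𝟙 (b x) * 𝟙 (b y))              ≈⟨ trans (*-congˡ (sym (𝟙-∧ _ _))) (sym (𝟙-∧ _ _)) ⟩
      𝟙 (edge b p)                                 ∎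
      where
      z = zVar n p
      x = xVar n (proj₁ (endpoints p))
      y = xVar n (proj₂ (endpoints p))

    factors : List (Fin (mPairs n)) → List (Pol (mPairs n))
    factors = List.map (λ p → oneP -P var p)

    ⟦product⟧ : ∀ ps → ⟦ prodP (factors ps) ⟧ w ≈ 𝟙 (all (not ∘ edge b) ps)
    ⟦product⟧ []       = ⟦⟧-const 1# w
    ⟦product⟧ (p ∷ ps) = begin
      ⟦ (oneP -P var p) *P prodP (factors ps) ⟧ w          ≈⟨ ⟦⟧-*P (oneP -P var p) (prodP (factors ps)) w ⟩
      ⟦ oneP -P var p ⟧ w * ⟦ prodP (factors ps) ⟧ w
        ≈⟨ *-cong (trans (⟦⟧-subP oneP (var p) w) (+-cong (⟦⟧-const 1# w) (-‿cong (trans (⟦⟧-var p w) (w≈edge p))))) (⟦product⟧ ps) ⟩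
      (1# - 𝟙 (edge b p)) * 𝟙 (all (not ∘ edge b) ps)    ≈⟨ *-congʳ (𝟙-not (edge b p)) ⟩
      𝟙 (not (edge b p)) * 𝟙 (all (not ∘ edge b) ps)     ≈⟨ 𝟙-∧ _ _ ⟨
      𝟙 (not (edge b p) ∧ all (not ∘ edge b) ps)         ∎
      where
      𝟙-not : ∀ a → 1# - 𝟙 a ≈ 𝟙 (not a)
      𝟙-not false = trans (+-congˡ -0#≈0#) (+-identityʳ 1#)
      𝟙-not true  = -‿inverseʳ 1#

  module _ (R : Refutation (fStarSystem n)) where
    open Refutation R using (computed; atZero; atSystem; linearT)

    G : Assignment N → Carrier
    G v = ⟦ computed ⟧ (point v 1#)

    f*-inverse : ∀ v → Boolean v → ⟦ fStar n ⟧ v * G v ≈ 1#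
    f*-inverse v v-boolean = begin
      f * G v                      ≈⟨ solve 2 (λ f g₁ → f :* g₁ := :0 :+ f :* (g₁ :- :0)) refl f (g 1#) ⟩
      0# + f * (g 1# - 0#)         ≈⟨ +-cong g0≈0 (*-congˡ (+-congˡ (-‿cong g0≈0))) ⟨
      g 0# + f * (g 1# - g 0#)     ≈⟨ g-affine f ⟨
      g f                          ≈⟨ ⟦⟧-cong computed (λ y → sym (⟦σ₁⟧≈point (fStarSystem n) v v-boolean y)) ⟩
      ⟦ computed ⟧ (λ y → ⟦ σ₁ N 1 (fStarSystem n) y ⟧ v) ≈⟨ ⟦⟧-substP computed (σ₁ N 1 (fStarSystem n)) v ⟨
      ⟦ substP computed (σ₁ N 1 (fStarSystem n)) ⟧ v      ≈⟨ ≈P⇒⟦⟧≈ (substP computed (σ₁ N 1 (fStarSystem n))) oneP atSystem v ⟩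
      ⟦ oneP ⟧ v                   ≈⟨ ⟦⟧-const 1# v ⟩
      1#                           ∎
      where
      f = ⟦ fStar n ⟧ v

      g : Carrier → Carrier
      g x = ⟦ computed ⟧ (point v x)

      g-affine : Affine g
      g-affine = degree≤1⇒affine t₀ (point v) (λ x → reflexive (point-t₀ v x))
                   (λ x x′ y y≢t₀ → reflexive (point-off v x x′ y y≢t₀)) computed (linearT zero)

      g0≈0 : g 0# ≈ 0#
      g0≈0 = begin
        g 0#                                          ≈⟨ ⟦⟧-cong computed (λ y → sym (⟦σ₀⟧≈point v y)) ⟩
        ⟦ computed ⟧ (λ y → ⟦ σ₀ N 1 y ⟧ v)            ≈⟨ ⟦⟧-substP computed (σ₀ N 1) v ⟨
        ⟦ substP computed (σ₀ N 1) ⟧ v                ≈⟨ ≈P⇒⟦⟧≈ (substP computed (σ₀ N 1)) zeroP atZero v ⟩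
        0#                                            ∎

    -- Solving (𝟙 d - 2) · G = 1 for d ∈ {0, 1}.
    𝟙-independent≈G : ∀ b → 𝟙 (independent b) ≈ - 1# + - (1# + 1#) * G (𝟙 ∘ b)
    𝟙-independent≈G b = solve-for (independent b) (⟦fStar⟧ b) (f*-inverse (𝟙 ∘ b) (𝟙-boolean b))
      where
      solve-for : ∀ d {f g} → f ≈ 𝟙 d - (1# + 1#) → f * g ≈ 1# → 𝟙 d ≈ - 1# + - (1# + 1#) * g
      solve-for true {f} {g} f≈ fg≈1 = sym (begin
        - 1# + - (1# + 1#) * g                    ≈⟨ solve 1 (λ g → :- :1 :+ (:- :2) :* g
                                                       := :- :1 :+ :2 :* ((:1 :- :2) :* g)) refl g ⟩
        - 1# + (1# + 1#) * ((1# - (1# + 1#)) * g) ≈⟨ +-congˡ (*-congˡ (trans (*-congʳ (sym f≈)) fg≈1)) ⟩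
        - 1# + (1# + 1#) * 1#                     ≈⟨ solve 0 (:- :1 :+ :2 :* :1 := :1) refl ⟩
        1#                                        ∎)
      solve-for false {f} {g} f≈ fg≈1 = sym (begin
        - 1# + - (1# + 1#) * g                    ≈⟨ +-congˡ (*-congʳ (+-identityˡ _)) ⟨
        - 1# + (0# - (1# + 1#)) * g               ≈⟨ +-congˡ (trans (*-congʳ (sym f≈)) fg≈1) ⟩
        - 1# + 1#                                 ≈⟨ -‿inverseˡ 1# ⟩
        0#                                        ∎)

-- The gadget reducing disjointness to f*: across a balanced cut, x_{left k} carries α_k,
-- x_{right k} carries β_k, and z selects exactly the pairs {left k, right k}.
module Embedding {c ℓ} (F : CommutativeRing c ℓ) (n : ℕ) (pos : Fin (2 ℕ.* n) → ℕ)
                 (B : Counting.BalancedCut n pos) where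

  open import Data.Nat as ℕ using (ℕ; zero; suc; _<_; _<?_)
  import Data.Nat.Properties as ℕ
  open import Data.Fin as Fin using (Fin; zero; suc; splitAt; toℕ)
  import Data.Fin.Properties as FinP
  open import Data.Vec as Vec using (Vec; []; _∷_)
  open import Data.List.Membership.Propositional using (_∈_)
  import Data.List.Membership.Propositional.Properties as ∈
  import Data.List.Relation.Unary.Any as Any
  import Data.List.Relation.Unary.Any.Properties as Any
  open import Data.Bool using (Bool; true; false; not; _∧_; T; if_then_else_)
  import Data.Bool.Properties as Bool
  open import Data.Product using (_×_; _,_; proj₁; proj₂; ∃)
  open import Data.Sum using (_⊎_; inj₁; inj₂; [_,_]′)
  open import Relation.Nullary using (¬_; Dec; yes; no; does; contradiction; _×-dec_; _⊎-dec_)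
  open import Relation.Nullary.Decidable using (dec-true; dec-false)
  open import Data.Unit using (tt)
  open import Function.Bundles using (Equivalence)
  open import Relation.Binary.PropositionalEquality as ≡ using (_≡_)
  open import Relation.Binary.Definitions using (tri<; tri≈; tri>)
  open import Function using (_∘_)
  open import Function.Definitions using (Injective)
  open import Data.Fin.Properties using (any?)
  open Counting using (BalancedCut)
  open BooleanVectors using (disjoint; T-disjoint; T-all-tabulate; T-ext)

  open Poly F using (pairs; mPairs; xVar)
  open Instance F n using (N; endpoints; edge; independent)
  open BalancedCut B

  pullback : ∀ {k} → (Fin n → Fin k) → Vec Bool n → Fin k → Bool
  pullback e α j with any? (λ i → e i Fin.≟ j)
  ... | yes (i , _) = Vec.lookup α i
  ... | no  _       = false

  pullback-apply : ∀ {k} {e : Fin n → Fin k} → Injective _≡_ _≡_ e → ∀ α i → pullback e α (e i) ≡ Vec.lookup α i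
  pullback-apply {e = e} e-injective α i with any? (λ i′ → e i′ Fin.≟ e i)
  ... | yes (i′ , eᵢ′≡eᵢ) = ≡.cong (Vec.lookup α) (e-injective eᵢ′≡eᵢ)
  ... | no  none          = contradiction (i , ≡.refl) none

  xBits : Vec Bool n → Vec Bool n → Fin (2 ℕ.* n) → Bool
  xBits α β j = if does (pos j <? cut) then pullback left α j else pullback right β j

  xBits-< : ∀ α β j → pos j < cut → xBits α β j ≡ pullback left α j
  xBits-< α β j j<cut rewrite dec-true (pos j <? cut) j<cut = ≡.refl

  xBits-≮ : ∀ α β j → ¬ pos j < cut → xBits α β j ≡ pullback right β j
  xBits-≮ α β j j≮cut rewrite dec-false (pos j <? cut) j≮cut = ≡.refl

  xBits-left : ∀ α β k → xBits α β (left k) ≡ Vec.lookup α k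
  xBits-left α β k = ≡.trans (xBits-< α β (left k) (left-< k)) (pullback-apply left-injective α k)

  xBits-right : ∀ α β k → xBits α β (right k) ≡ Vec.lookup β k
  xBits-right α β k = ≡.trans (xBits-≮ α β (right k) (right-≮ k)) (pullback-apply right-injective β k)

  endpoints-onto : ∀ a b → toℕ a < toℕ b → ∃ λ p → endpoints p ≡ (a , b)
  endpoints-onto a b a<b = Any.index ab∈pairs , ≡.sym (Any.lookup-index ab∈pairs)
    where
    ab∈pairs : (a , b) ∈ pairs (2 ℕ.* n)
    ab∈pairs = ∈.∈-filter⁺ (λ p → toℕ (proj₁ p) <? toℕ (proj₂ p))
                 (∈.∈-cartesianProduct⁺ (∈.∈-allFin a) (∈.∈-allFin b)) a<b

  Linked : Fin (2 ℕ.* n) → Fin (2 ℕ.* n) → Set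
  Linked a b = ∃ λ k → (left k ≡ a × right k ≡ b) ⊎ (right k ≡ a × left k ≡ b)

  linked? : ∀ a b → Dec (Linked a b)
  linked? a b = any? λ k → (left k Fin.≟ a ×-dec right k Fin.≟ b) ⊎-dec (right k Fin.≟ a ×-dec left k Fin.≟ b)

  linked : Fin (2 ℕ.* n) → Fin (2 ℕ.* n) → Bool
  linked a b = does (linked? a b)

  linked-sound : ∀ a b → T (linked a b) → Linked a b
  linked-sound a b t with linked? a b
  ... | yes ab = ab

  linked-complete : ∀ a b → Linked a b → T (linked a b)
  linked-complete a b ab with linked? a b
  ... | yes _   = tt
  ... | no ¬ab = ¬ab ab

  zBits : Fin (mPairs n) → Bool
  zBits p = linked (proj₁ (endpoints p)) (proj₂ (endpoints p))

  bits : Vec Bool n → Vec Bool n → Fin N → Bool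
  bits α β = [ zBits , xBits α β ]′ ∘ splitAt (mPairs n)

  edgeAt : Vec Bool n → Vec Bool n → Fin (2 ℕ.* n) × Fin (2 ℕ.* n) → Bool
  edgeAt α β ab = linked (proj₁ ab) (proj₂ ab) ∧ (xBits α β (proj₁ ab) ∧ xBits α β (proj₂ ab))

  edge-bits : ∀ α β p → edge (bits α β) p ≡ edgeAt α β (endpoints p)
  edge-bits α β p = ≡.cong₂ _∧_ (≡.cong [ zBits , xBits α β ]′ (FinP.splitAt-↑ˡ (mPairs n) p (2 ℕ.* n)))
                                (≡.cong₂ _∧_ (x-bits (proj₁ (endpoints p))) (x-bits (proj₂ (endpoints p))))
    where
    x-bits : ∀ j → bits α β (xVar n j) ≡ xBits α β j
    x-bits j = ≡.cong [ zBits , xBits α β ]′ (FinP.splitAt-↑ʳ (mPairs n) (2 ℕ.* n) j)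

  module _ (α β : Vec Bool n) where

    disjoint⇒no-edge : T (disjoint α β) → ∀ a b → T (not (edgeAt α β (a , b)))
    disjoint⇒no-edge disj a b with linked a b in a-b
    ... | false = tt
    ... | true with linked-sound a b (≡.subst T (≡.sym a-b) tt)
    ...   | k , inj₁ (≡.refl , ≡.refl) rewrite xBits-left α β k | xBits-right α β k =
      Equivalence.to (T-disjoint α β) disj k
    ...   | k , inj₂ (≡.refl , ≡.refl)
      rewrite xBits-left α β k | xBits-right α β k | Bool.∧-comm (Vec.lookup β k) (Vec.lookup α k) =
      Equivalence.to (T-disjoint α β) disj k

    no-edge⇒disjoint : (∀ p → T (not (edge (bits α β) p))) → T (disjoint α β)
    no-edge⇒disjoint no-edge = Equivalence.from (T-disjoint α β) separated
      where
      no-edge-at : ∀ a b → toℕ a < toℕ b → T (not (edgeAt α β (a , b)))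
      no-edge-at a b a<b with endpoints-onto a b a<b
      ... | p , endpoints≡ = ≡.subst (T ∘ not ∘ edgeAt α β) endpoints≡ (≡.subst (T ∘ not) (edge-bits α β p) (no-edge p))

      at-pair : ∀ k a b → Linked a b → (xBits α β a ∧ xBits α β b) ≡ (Vec.lookup α k ∧ Vec.lookup β k) → toℕ a < toℕ b →
                T (not (Vec.lookup α k ∧ Vec.lookup β k))
      at-pair k a b ab-linked ab≡αβ a<b =
        ≡.subst (T ∘ not) (≡.cong₂ _∧_ (Equivalence.to Bool.T-≡ (linked-complete a b ab-linked)) ab≡αβ) (no-edge-at a b a<b)

      separated : ∀ k → T (not (Vec.lookup α k ∧ Vec.lookup β k))
      separated k with ℕ.<-cmp (toℕ (left k)) (toℕ (right k))
      ... | tri< l<r _ _ = at-pair k (left k) (right k) (k , inj₁ (≡.refl , ≡.refl))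
                             (≡.cong₂ _∧_ (xBits-left α β k) (xBits-right α β k)) l<r
      ... | tri> _ _ r<l = at-pair k (right k) (left k) (k , inj₂ (≡.refl , ≡.refl))
                             (≡.trans (≡.cong₂ _∧_ (xBits-right α β k) (xBits-left α β k)) (Bool.∧-comm (Vec.lookup β k) (Vec.lookup α k))) r<l
      ... | tri≈ _ l≡r _ = contradiction (≡.subst (_< cut) (≡.cong pos (FinP.toℕ-injective l≡r)) (left-< k)) (right-≮ k)

    independent-bits : independent (bits α β) ≡ disjoint α β
    independent-bits = T-ext
      (λ t → no-edge⇒disjoint (Equivalence.to (T-all-tabulate (not ∘ edge (bits α β)) (λ p → p)) t))
      (λ d → Equivalence.from (T-all-tabulate (not ∘ edge (bits α β)) (λ p → p)) λ p →
         ≡.subst (T ∘ not) (≡.sym (edge-bits α β p)) (disjoint⇒no-edge d (proj₁ (endpoints p)) (proj₂ (endpoints p))))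

module LowerBound {c ℓ} (F : CommutativeRing c ℓ) (isField : IsField F) (n : ℕ)
                  (R : Poly.Refutation F (Poly.fStarSystem F n)) where

  open import Data.Nat as ℕ using (ℕ; zero; suc; _≤_; _<_; _^_; z≤n; s≤s)
  import Data.Nat.Properties as ℕ
  open import Data.Fin using (Fin; zero; suc; splitAt; toℕ)
  import Data.Fin.Properties as FinP
  open import Data.Fin.Permutation using (_⟨$⟩ʳ_; _⟨$⟩ˡ_; inverseˡ; inverseʳ)
  open import Data.Vec as Vec using (Vec)
  open import Data.Bool using (Bool; true; false)
  open import Data.Sum using (inj₁; inj₂; [_,_]′)
  open import Relation.Binary.PropositionalEquality as ≡ using (_≡_; _≢_)
  open import Function using (_∘_)
  import Algebra.Properties.Semiring.Sum
  import Relation.Binary.Reasoning.Setoid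
  open Counting using (BalancedCut; balanced-cut)
  open BooleanVectors using (disjoint)

  open CommutativeRing F hiding (zero)
  open Poly F
  open Refutation R using (order; program; width; degree; size)
  open Algebra.Properties.Semiring.Sum semiring using (sum; sum-syntax; *-distribˡ-sum)
  open LinearAlgebra F using (𝟙; disjointness-rank)
  open BranchingPrograms F
  open Instance F n using (N; M; point; G; 𝟙-independent≈G)

  -- the layer of the program reading x_j
  pos : Fin (2 ℕ.* n) → ℕ
  pos j = toℕ (order ⟨$⟩ˡ vVar N 1 (xVar n j))

  pos-injective : ∀ {i j} → pos i ≡ pos j → i ≡ j
  pos-injective pᵢ≡pⱼ = FinP.↑ʳ-injective (mPairs n) _ _ (FinP.↑ˡ-injective (1 ℕ.+ N) _ _
    (≡.trans (≡.sym (inverseʳ order)) (≡.trans (≡.cong (order ⟨$⟩ʳ_) (FinP.toℕ-injective pᵢ≡pⱼ)) (inverseʳ order))))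

  balanced : BalancedCut n pos
  balanced = balanced-cut n M pos pos-injective (λ j → FinP.toℕ<n _)

  open BalancedCut balanced using (cut)
  open Embedding F n pos balanced using (xBits; zBits; bits; xBits-<; xBits-≮; independent-bits)

  inputs : Vec Bool n → Vec Bool n → Fin M → Carrier
  inputs α β t = point (𝟙 ∘ bits α β) 1# (order ⟨$⟩ʳ t)

  [,]-local : ∀ {a b c} {A : Set a} {B : Set b} {C : Set c} (f f′ : A → C) (g g′ : B → C) x →
              (∀ a → x ≡ inj₁ a → f a ≡ f′ a) → (∀ b → x ≡ inj₂ b → g b ≡ g′ b) → [ f , g ]′ x ≡ [ f′ , g′ ]′ x
  [,]-local f f′ g g′ (inj₁ a) f≡ g≡ = f≡ a ≡.refl
  [,]-local f f′ g g′ (inj₂ b) f≡ g≡ = g≡ b ≡.refl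

  -- Layer t reads x_j only if pos j ≡ t, and every other variable is read the same for all α, β.
  inputs-local : ∀ α β α′ β′ t → (∀ j → pos j ≡ toℕ t → xBits α β j ≡ xBits α′ β′ j) →
                 inputs α β t ≡ inputs α′ β′ t
  inputs-local α β α′ β′ t same = [,]-local (𝟙 ∘ bits α β) (𝟙 ∘ bits α′ β′) _ _ (splitAt N y) v-part (λ _ _ → ≡.refl)
    where
    y = order ⟨$⟩ʳ t

    v-part : ∀ i → splitAt N y ≡ inj₁ i → 𝟙 (bits α β i) ≡ 𝟙 (bits α′ β′ i)
    v-part i split₁ = ≡.cong 𝟙 ([,]-local zBits zBits (xBits α β) (xBits α′ β′) (splitAt (mPairs n) i) (λ _ _ → ≡.refl) x-part)
      where
      x-part : ∀ j → splitAt (mPairs n) i ≡ inj₂ j → xBits α β j ≡ xBits α′ β′ j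
      x-part j split₂ = same j (≡.cong toℕ (≡.trans (≡.cong (order ⟨$⟩ˡ_) y≡xⱼ) (inverseˡ order)))
        where
        y≡xⱼ : vVar N 1 (xVar n j) ≡ y
        y≡xⱼ = ≡.trans (≡.cong (vVar N 1) (FinP.splitAt⁻¹-↑ʳ split₂)) (FinP.splitAt⁻¹-↑ˡ split₁)

  ∅ : Vec Bool n
  ∅ = Vec.replicate n false

  inputs-splice : ∀ α β t → inputs α β t ≡ splice cut (inputs α ∅) (inputs ∅ β) t
  inputs-splice α β t = splice-cases cut (inputs α ∅) (inputs ∅ β) t
    (λ t<cut → inputs-local α β α ∅ t λ j pⱼ≡t →
       let j<cut = ≡.subst (_< cut) (≡.sym pⱼ≡t) t<cut in ≡.trans (xBits-< α β j j<cut) (≡.sym (xBits-< α ∅ j j<cut)))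
    (λ t≮cut → inputs-local α β ∅ β t λ j pⱼ≡t →
       let j≮cut = t≮cut ∘ ≡.subst (_< cut) pⱼ≡t in ≡.trans (xBits-≮ α β j j≮cut) (≡.sym (xBits-≮ ∅ β j j≮cut)))

  G≈value : ∀ α β → G R (𝟙 ∘ bits α β) ≈ value program (inputs α β) zero
  G≈value α β = ⟦⟧-evalABP (order ⟨$⟩ʳ_) program zero (point (𝟙 ∘ bits α β) 1#)

  open Factorisation (factorise program cut)

  𝟙-disjoint≈value : ∀ α β → 𝟙 (disjoint α β) ≈ - 1# + - (1# + 1#) * value program (inputs α β) zero
  𝟙-disjoint≈value α β = begin
    𝟙 (disjoint α β)                                          ≡⟨ ≡.cong 𝟙 (independent-bits α β) ⟨
    𝟙 (Instance.independent F n (bits α β))                   ≈⟨ 𝟙-independent≈G R (bits α β) ⟩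
    - 1# + - (1# + 1#) * G R (𝟙 ∘ bits α β)                   ≈⟨ +-congˡ (*-congˡ (G≈value α β)) ⟩
    - 1# + - (1# + 1#) * value program (inputs α β) zero      ∎
    where open Relation.Binary.Reasoning.Setoid setoid

  -- Cutting the program between the layers reading the α-half and the β-half of x writes the
  -- disjointness matrix as a product through cutWidth + 1 intermediate coordinates.
  U : Vec Bool n → Fin (suc cutWidth) → Carrier
  U α zero    = - 1#
  U α (suc b) = - (1# + 1#) * prefix (inputs α ∅) zero b

  V : Fin (suc cutWidth) → Vec Bool n → Carrier
  V zero    β = 1#
  V (suc b) β = suffix (inputs ∅ β) b

  disjoint≈UV : ∀ α β → 𝟙 (disjoint α β) ≈ ∑[ k < suc cutWidth ] (U α k * V k β)
  disjoint≈UV α β = begin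
    𝟙 (disjoint α β)
      ≈⟨ 𝟙-disjoint≈value α β ⟩
    - 1# + - (1# + 1#) * value program (inputs α β) zero
      ≈⟨ +-cong (sym (*-identityʳ _)) (*-congˡ (value-cong program (λ t → reflexive (inputs-splice α β t)) zero)) ⟩
    - 1# * 1# + - (1# + 1#) * value program (splice cut (inputs α ∅) (inputs ∅ β)) zero
      ≈⟨ +-congˡ (*-congˡ (value≈∑ (inputs α ∅) (inputs ∅ β) zero)) ⟩
    - 1# * 1# + - (1# + 1#) * ∑[ b < cutWidth ] (prefix (inputs α ∅) zero b * suffix (inputs ∅ β) b)
      ≈⟨ +-congˡ (trans (*-distribˡ-sum {cutWidth} _ _) (sum-cong-≋ {cutWidth} λ b → sym (*-assoc _ _ _))) ⟩
    ∑[ k < suc cutWidth ] (U α k * V k β) ∎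
    where
    open Algebra.Properties.Semiring.Sum semiring using (sum-cong-≋)
    open Relation.Binary.Reasoning.Setoid setoid

  2^n≤1+width : 2 ^ n ≤ suc width
  2^n≤1+width = ℕ.≤-trans (disjointness-rank isField n (suc cutWidth) U V disjoint≈UV) (s≤s cutWidth≤)

  -- A constant program cannot distinguish intersecting from disjoint inputs.
  degree≢0 : 1 ≤ n → degree ≢ 0
  degree≢0 1≤n degree≡0 = IsField.1≉0 isField (begin
    1#                                                         ≡⟨ ≡.cong 𝟙 (disjoint-∅ n) ⟨
    𝟙 (disjoint ∅ ∅)                                           ≈⟨ 𝟙-disjoint≈value ∅ ∅ ⟩
    - 1# + - (1# + 1#) * value program (inputs ∅ ∅) zero       ≈⟨ +-congˡ (*-congˡ (value-constant program degree≡0 _ _ zero)) ⟩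
    - 1# + - (1# + 1#) * value program (inputs 𝟏 𝟏) zero       ≈⟨ 𝟙-disjoint≈value 𝟏 𝟏 ⟨
    𝟙 (disjoint 𝟏 𝟏)                                           ≡⟨ ≡.cong 𝟙 (disjoint-𝟏 1≤n) ⟩
    0#                                                         ∎)
    where
    open Relation.Binary.Reasoning.Setoid setoid

    𝟏 : Vec Bool n
    𝟏 = Vec.replicate n true

    disjoint-∅ : ∀ k → disjoint (Vec.replicate k false) (Vec.replicate k false) ≡ true
    disjoint-∅ zero    = ≡.refl
    disjoint-∅ (suc k) = disjoint-∅ k

    disjoint-𝟏 : ∀ {k} → 1 ≤ k → disjoint (Vec.replicate k true) (Vec.replicate k true) ≡ false
    disjoint-𝟏 {suc k} _ = ≡.refl

  width≤size : 1 ≤ n → width ≤ size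
  width≤size 1≤n = begin
    width                        ≤⟨ ℕ.m≤n*m width M ⟩
    M ℕ.* width                  ≤⟨ ℕ.m≤m*n (M ℕ.* width) degree ⟩
    M ℕ.* width ℕ.* degree       ≤⟨ ℕ.m≤m*n (M ℕ.* width ℕ.* degree) M ⟩
    M ℕ.* width ℕ.* degree ℕ.* M ∎
    where
    open ℕ.≤-Reasoning
    instance
      M-nonZero : ℕ.NonZero M
      M-nonZero = ℕ.>-nonZero (ℕ.≤-trans (s≤s z≤n) (ℕ.m≤n+m (suc N) N))
      degree-nonZero : ℕ.NonZero degree
      degree-nonZero = ℕ.≢-nonZero (degree≢0 1≤n)

  lower-bound : 1 ≤ n → 2 ^ n ≤ 2 ℕ.* (size ℕ.* 1)
  lower-bound 1≤n = begin
    2 ^ n                   ≤⟨ 2^n≤1+width ⟩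
    suc width               ≤⟨ ℕ.+-monoˡ-≤ width (source-width≤width program) ⟩
    width ℕ.+ width         ≡⟨ ≡.cong (width ℕ.+_) (ℕ.+-identityʳ width) ⟨
    2 ℕ.* width             ≤⟨ ℕ.*-monoʳ-≤ 2 (width≤size 1≤n) ⟩
    2 ℕ.* size              ≡⟨ ≡.cong (2 ℕ.*_) (ℕ.*-identityʳ size) ⟨
    2 ℕ.* (size ℕ.* 1)      ∎
    where open ℕ.≤-Reasoning

open import Data.Nat using (_≤_; _<_; _*_; _^_)
open import Data.Nat.Primality using (Prime)
open import Data.Product using (Σ; _,_)

-- The bound holds over every field; the characteristic assumption only makes f* = 0 unsatisfiable
-- over {0, 1}, i.e. makes refutations exist at all.
corollary5p6 : ∀ {c ℓ} (q : ℕ) → Prime q → 2 < q →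
    Σ ℕ λ a → Σ ℕ λ b →
    (F : CommutativeRing c ℓ) → IsFiniteField F → HasCharacteristic F q →
    (n : ℕ) → 1 ≤ n →
    (R : Poly.Refutation F (Poly.fStarSystem F n)) →
    2 ^ n ≤ a * Poly.Refutation.size R ^ b
corollary5p6 q _ _ = 2 , 1 , λ F finiteField _ n 1≤n R →
  LowerBound.lower-bound F (IsFiniteField.isField finiteField) n R 1≤n
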